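{- Let $n,m\ge1$, $d=n+\binom n2$, $r\in\mathbb{N}$, and $a\in\{0,r\}^d$. Then for all faces $F^1,\dots,F^m$ of $P(K_n)$ with $a\in F^1+\dots+F^m$ (Minkowski sum), there exist vertices $\chi^b$ of $F^b$, $b\in[m]$, such that $a=\sum_{b=1}^m\chi^b$.
   Context: Vectors in $\mathbb{R}^d$ are indexed by $[n]\sqcup\binom{[n]}{2}$. For $S\subseteq[n]$, $a_S\in\{0,1\}^d$ has $a_{S,i}=1$ iff $i\in S$ and $a_{S,ij}=1$ iff $i,j\in S$. $P(K_n)=\mathrm{conv}\{a_S:S\subseteq[n]\}$ is the correlation polytope.
   Formalization: Vectors have rational rather than real coordinates, so the point $a$, the convex weights defining $P(K_n)$, the inequalities cutting out the faces and the Minkowski summands are all rational. -}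

module Defs where

open import Data.Nat using (ℕ; zero; suc)
open import Data.Fin using (Fin; zero; suc) renaming (_<_ to _<ᶠ_)
open import Data.Fin.Properties using (_<?_)
open import Data.Bool using (Bool; true; false; _∧_; if_then_else_)
open import Data.Product using (Σ; _×_; _,_; ∃; ∃-syntax)
open import Data.Sum using (_⊎_; inj₁; inj₂)
open import Data.List using (List; []; _∷_)
open import Data.List.Relation.Unary.All using (All)
open import Data.Integer using (+_)
open import Data.Rational using (ℚ; 0ℚ; 1ℚ; _+_; _*_; _-_; _≤_; _<_; _/_)
open import Relation.Binary.PropositionalEquality using (_≡_)
open import Relation.Nullary using (yes; no)

-- Index set [n] ⊔ ([n] choose 2); a 2-subset {i,j} is written (i , j , i<j).
Idx : ℕ → Set
Idx n = Fin n ⊎ Σ (Fin n × Fin n) (λ p → Data.Product.proj₁ p <ᶠ Data.Product.proj₂ p)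

Vec : ℕ → Set
Vec n = Idx n → ℚ

Subset : ℕ → Set
Subset n = Fin n → Bool

b2q : Bool → ℚ
b2q true = 1ℚ
b2q false = 0ℚ

aS : ∀ {n} → Subset n → Vec n
aS S (inj₁ i) = b2q (S i)
aS S (inj₂ ((i , j) , _)) = b2q (S i ∧ S j)

sumFin : ∀ {k} → (Fin k → ℚ) → ℚ
sumFin {zero} f = 0ℚ
sumFin {suc k} f = f zero + sumFin (λ i → f (suc i))

sumPairs : ∀ {n} → (Σ (Fin n × Fin n) (λ p → Data.Product.proj₁ p <ᶠ Data.Product.proj₂ p) → ℚ) → ℚ
sumPairs {n} f = sumFin (λ i → sumFin (λ j → g i j))
  where
  g : Fin n → Fin n → ℚ
  g i j with i <? j
  ... | yes p = f ((i , j) , p)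
  ... | no _ = 0ℚ

dot : ∀ {n} → Vec n → Vec n → ℚ
dot c x = sumFin (λ i → c (inj₁ i) * x (inj₁ i)) + sumPairs (λ p → c (inj₂ p) * x (inj₂ p))

combo : ∀ {n} → List (ℚ × Subset n) → Vec n
combo [] k = 0ℚ
combo ((l , S) ∷ ws) k = l * aS S k + combo ws k

weightSum : ∀ {n} → List (ℚ × Subset n) → ℚ
weightSum [] = 0ℚ
weightSum ((l , _) ∷ ws) = l + weightSum ws

InP : ∀ {n} → Vec n → Set
InP {n} x = ∃[ ws ] (All (λ w → 0ℚ ≤ Data.Product.proj₁ w) ws
                     × weightSum {n} ws ≡ 1ℚ
                     × (∀ k → x k ≡ combo ws k))

-- A face of P(K_n): P ∩ {x : c·x = δ} for a valid inequality c·x ≤ δ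
-- (includes the empty face and P itself).
record Face (n : ℕ) : Set where
  field
    c : Vec n
    δ : ℚ
    valid : ∀ x → InP x → dot c x ≤ δ

_∈F_ : ∀ {n} → Vec n → Face n → Set
x ∈F F = InP x × dot (Face.c F) x ≡ Face.δ F

IsVertex : ∀ {n} → Face n → Vec n → Set
IsVertex F x = x ∈F F
  × (∀ y z (l : ℚ) → y ∈F F → z ∈F F → 0ℚ < l → l < 1ℚ
       → (∀ k → x k ≡ l * y k + (1ℚ - l) * z k) → ∀ k → y k ≡ z k)

sumVecs : ∀ {n m} → (Fin m → Vec n) → Vec n
sumVecs v k = sumFin (λ b → v b k)

InMinkowski : ∀ {n m} → Vec n → (Fin m → Face n) → Set
InMinkowski {n} {m} a F = ∃[ x ] ((∀ b → x b ∈F F b) × (∀ k → a k ≡ sumVecs {n} {m} x k))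

ℕtoℚ : ℕ → ℚ
ℕtoℚ r = + r / 1

{-# OPTIONS --safe #-}
-- Write each x^b ∈ F^b as a convex combination of points a_S. Every S of positive weight
-- (call it supported) has a_S ∈ F^b, and a 0/1 point of a face is a vertex of it. Since a ∈ {0, r}^d
-- and a_ij ≤ a_i on every a_S, a nonzero a_ij forces S_i = S_j on all supported S, so two
-- supported sets that meet are equal. Grouping supported sets by least element gives a
-- row-stochastic m × (n + 1) matrix whose column sums are the integers a_i ∈ {0, r} (and m minus
-- their sum for the empty set). Hall's theorem with demands rounds it to an assignment of blocks
-- to b ∈ [m] with the same support and column sums; one supported set per assigned block, taken
-- from x^b, gives the vertices.
module Submission where

open import Defs
open import Algebra.Bundles using (CommutativeMonoid; CommutativeRing)
import Algebra.Properties.CommutativeMonoid.Sum as MonoidSum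
import Algebra.Properties.CommutativeSemigroup as CommutativeSemigroupProperties
import Algebra.Properties.Group as GroupProperties
import Algebra.Properties.Semiring.Sum as SemiringSum
open import Data.Bool using (Bool; true; false; not; _∧_; _∨_; if_then_else_)
import Data.Bool.Properties as BoolP
open import Data.Empty using (⊥-elim)
open import Data.Fin using (Fin; zero; suc) renaming (_<_ to _<ᶠ_)
open import Data.Fin.Properties using (_≟_)
import Data.Fin.Properties as FinP
open import Data.Fin.Subset.Properties using (anySubset?)
import Data.Integer as ℤ
import Data.Integer.Properties as ℤP
open import Data.List using (List; []; _∷_)
open import Data.List.Membership.Propositional using (_∈_)
open import Data.List.Relation.Unary.All using (All; []; _∷_)
open import Data.List.Relation.Unary.Any using (here; there)
open import Data.Maybe as Maybe using (Maybe; just; nothing; is-just)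
open import Data.Nat as ℕ using (ℕ; zero; suc; _≤_; _<_)
import Data.Nat.Coprimality as Coprime
open import Data.Nat.Induction using (<-rec)
import Data.Nat.Properties as ℕP
open import Data.Product using (Σ; Σ-syntax; _×_; _,_; proj₁; proj₂; ∃-syntax)
open import Data.Rational as ℚ using (ℚ; 0ℚ; 1ℚ; mkℚ; _+_; _*_; _-_; -_)
import Data.Rational.Properties as ℚP
open import Data.Rational.Solver using (module +-*-Solver)
open import Data.Sum using (_⊎_; inj₁; inj₂)
open import Data.Vec using (lookup; tabulate)
open import Data.Vec.Properties using (lookup∘tabulate)
open import Function using (_∘_; mk⇔)
open import Relation.Binary.Definitions using (tri<; tri≈; tri>)
open import Relation.Binary.PropositionalEquality
open import Relation.Nullary using (¬_; Dec; does; yes; no)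
import Relation.Nullary.Decidable as Dec
open import Relation.Nullary.Decidable using (_×-dec_)

open +-*-Solver using (solve; _:=_; _:+_; _:*_)
open GroupProperties ℚP.+-0-group using (identityʳ-unique; x∙y⁻¹≈ε⇒x≈y; ∙-cancelʳ)
open MonoidSum ℕP.+-0-commutativeMonoid using ()
  renaming (sum to sumℕ; sum-cong-≗ to sumℕ-cong; ∑-distrib-+ to sumℕ-+; ∑-comm to sumℕ-comm; sum-replicate-zero to sumℕ-zero)
open CommutativeSemigroupProperties (CommutativeMonoid.commutativeSemigroup BoolP.∨-commutativeMonoid)
  using () renaming (interchange to ∨-interchange)
open SemiringSum (CommutativeRing.semiring ℚP.+-*-commutativeRing)
  using (sum; sum-syntax; sum-cong-≗; ∑-distrib-+; ∑-comm; *-distribˡ-sum; sum-replicate-zero)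

𝟙 : Bool → ℕ
𝟙 x = if x then 1 else 0

count : ∀ {k} → (Fin k → Bool) → ℕ
count P = sumℕ (λ i → 𝟙 (P i))

anyᵇ : ∀ {k} → (Fin k → Bool) → Bool
anyᵇ {zero} P = false
anyᵇ {suc k} P = P zero ∨ anyᵇ (P ∘ suc)

sumℕ-mono-≤ : ∀ {k} {f g : Fin k → ℕ} → (∀ i → f i ≤ g i) → sumℕ f ≤ sumℕ g
sumℕ-mono-≤ {zero} _ = ℕ.z≤n
sumℕ-mono-≤ {suc k} f≤g = ℕP.+-mono-≤ (f≤g zero) (sumℕ-mono-≤ (f≤g ∘ suc))

term≤sumℕ : ∀ {k} (f : Fin k → ℕ) i → f i ≤ sumℕ f
term≤sumℕ f zero = ℕP.m≤m+n (f zero) _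
term≤sumℕ f (suc i) = ℕP.≤-trans (term≤sumℕ (f ∘ suc) i) (ℕP.m≤n+m _ (f zero))

sumℕ≡0 : ∀ {k} (f : Fin k → ℕ) → sumℕ f ≡ 0 → ∀ i → f i ≡ 0
sumℕ≡0 f Σf≡0 i = ℕP.n≤0⇒n≡0 (subst (f i ≤_) Σf≡0 (term≤sumℕ f i))

sumℕ≢0 : ∀ {k} (f : Fin k → ℕ) → sumℕ f ≢ 0 → ∃[ i ] 0 < f i
sumℕ≢0 {zero} f Σf≢0 = ⊥-elim (Σf≢0 refl)
sumℕ≢0 {suc k} f Σf≢0 with f zero ℕ.≟ 0
... | no f₀≢0 = zero , ℕP.n≢0⇒n>0 f₀≢0
... | yes f₀≡0 with sumℕ≢0 (f ∘ suc) (λ Σ≡0 → Σf≢0 (cong₂ ℕ._+_ f₀≡0 Σ≡0))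
...   | i , 0<fᵢ = suc i , 0<fᵢ

sumℕ-δ : ∀ {k} (i : Fin k) (g : Fin k → ℕ) → sumℕ (λ j → if does (i ≟ j) then g j else 0) ≡ g i
sumℕ-δ {suc k} zero g = trans (cong (g zero ℕ.+_) (sumℕ-zero k)) (ℕP.+-identityʳ (g zero))
sumℕ-δ {suc k} (suc i) g = sumℕ-δ i (g ∘ suc)

𝟙-mono : ∀ {x y} → (x ≡ true → y ≡ true) → 𝟙 x ≤ 𝟙 y
𝟙-mono {false} _ = ℕ.z≤n
𝟙-mono {true} x⇒y rewrite x⇒y refl = ℕP.≤-refl

𝟙≤1 : ∀ x → 𝟙 x ≤ 1
𝟙≤1 x = 𝟙-mono {x} {true} (λ _ → refl)

count-mono : ∀ {k} {P Q : Fin k → Bool} → (∀ i → P i ≡ true → Q i ≡ true) → count P ≤ count Q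
count-mono P⇒Q = sumℕ-mono-≤ (λ i → 𝟙-mono (P⇒Q i))

count≤ : ∀ {k} (P : Fin k → Bool) → count P ≤ k
count≤ {zero} P = ℕ.z≤n
count≤ {suc k} P = ℕP.+-mono-≤ (𝟙≤1 (P zero)) (count≤ (P ∘ suc))

count-full : ∀ {k} (P : Fin k → Bool) → count P ≡ k → ∀ i → P i ≡ true
count-full {suc k} P count≡ i with P zero in P₀
count-full {suc k} P count≡ zero    | true = P₀
count-full {suc k} P count≡ (suc i) | true = count-full (P ∘ suc) (ℕP.suc-injective count≡) i
... | false = ⊥-elim (ℕP.1+n≰n (subst (_≤ k) count≡ (count≤ (P ∘ suc))))

count≢0 : ∀ {k} (P : Fin k → Bool) → count P ≢ 0 → ∃[ i ] P i ≡ true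
count≢0 P count≢0 with sumℕ≢0 (λ i → 𝟙 (P i)) count≢0
... | i , 0<𝟙Pᵢ with P i in Pᵢ
...   | true = i , Pᵢ

anyᵇ-witness : ∀ {k} (P : Fin k → Bool) → anyᵇ P ≡ true → ∃[ i ] P i ≡ true
anyᵇ-witness {suc k} P any≡true with P zero in P₀
... | true = zero , P₀
... | false with anyᵇ-witness (P ∘ suc) any≡true
...   | i , Pᵢ = suc i , Pᵢ

anyᵇ-intro : ∀ {k} (P : Fin k → Bool) i → P i ≡ true → anyᵇ P ≡ true
anyᵇ-intro P zero P₀ rewrite P₀ = refl
anyᵇ-intro P (suc i) Pᵢ = trans (cong (P zero ∨_) (anyᵇ-intro (P ∘ suc) i Pᵢ)) (BoolP.∨-zeroʳ (P zero))

anyᵇ-mono : ∀ {k} {P Q : Fin k → Bool} → (∀ i → P i ≡ true → Q i ≡ true) → anyᵇ P ≡ true → anyᵇ Q ≡ true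
anyᵇ-mono {P = P} {Q} P⇒Q anyP with anyᵇ-witness P anyP
... | i , Pᵢ = anyᵇ-intro Q i (P⇒Q i Pᵢ)

anyᵇ-cong : ∀ {k} {P Q : Fin k → Bool} → (∀ i → P i ≡ Q i) → anyᵇ P ≡ anyᵇ Q
anyᵇ-cong {zero} P≗Q = refl
anyᵇ-cong {suc k} P≗Q = cong₂ _∨_ (P≗Q zero) (anyᵇ-cong (P≗Q ∘ suc))

anyᵇ-∨ : ∀ {k} (P Q : Fin k → Bool) → anyᵇ (λ i → P i ∨ Q i) ≡ anyᵇ P ∨ anyᵇ Q
anyᵇ-∨ {zero} P Q = refl
anyᵇ-∨ {suc k} P Q =
  trans (cong ((P zero ∨ Q zero) ∨_) (anyᵇ-∨ (P ∘ suc) (Q ∘ suc))) (∨-interchange (P zero) (Q zero) _ _)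

true≢false : true ≢ false
true≢false ()

∧-intro : ∀ {x y} → x ≡ true → y ≡ true → x ∧ y ≡ true
∧-intro refl refl = refl

hits : ∀ {q} → Maybe (Fin q) → Fin q → Bool
hits nothing _ = false
hits (just i) j = does (i ≟ j)

hits-total : ∀ {q} (x : Maybe (Fin q)) → sumℕ (λ j → 𝟙 (hits x j)) ≡ 𝟙 (is-just x)
hits-total {q} nothing = sumℕ-zero q
hits-total (just i) = sumℕ-δ i (λ _ → 1)

-- Hall's theorem with demands

module Hall {m q : ℕ} (R : Fin m → Fin q → Bool) where

  open ℕP.≤-Reasoning

  restrict : (Fin q → Bool) → (Fin q → ℕ) → Fin q → ℕ
  restrict J c j = if J j then c j else 0

  demand : (Fin q → ℕ) → (Fin q → Bool) → ℕ
  demand c J = sumℕ (restrict J c)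

  neighbours : (Fin q → Bool) → Fin m → Bool
  neighbours J b = anyᵇ (λ j → J j ∧ R b j)

  supply : (Fin m → Bool) → (Fin q → Bool) → ℕ
  supply U J = count (λ b → U b ∧ neighbours J b)

  HallCondition : (Fin m → Bool) → (Fin q → ℕ) → Set
  HallCondition U c = ∀ J → demand c J ≤ supply U J

  record Matching (U : Fin m → Bool) (c : Fin q → ℕ) : Set where
    field
      match : Fin m → Maybe (Fin q)
      match-edge : ∀ {b j} → match b ≡ just j → U b ≡ true × R b j ≡ true
      match-count : ∀ j → count (λ b → hits (match b) j) ≡ c j

    unmatched : ∀ {b} → U b ≡ false → match b ≡ nothing
    unmatched {b} Ub≡false with match b in match≡
    ... | nothing = refl
    ... | just j with () ← trans (sym Ub≡false) (proj₁ (match-edge match≡))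

  empty-matching : ∀ {U c} → (∀ j → c j ≡ 0) → Matching U c
  empty-matching {c = c} c≡0 = record
    { match = λ _ → nothing
    ; match-edge = λ ()
    ; match-count = λ j → trans (sumℕ-zero m) (sym (c≡0 j))
    }

  edge-matching : ∀ {U : Fin m → Bool} {b₀ j₀} → U b₀ ≡ true → R b₀ j₀ ≡ true →
                  Matching (λ b → does (b₀ ≟ b) ∧ U b) (λ j → 𝟙 (does (j₀ ≟ j)))
  edge-matching {U} {b₀} {j₀} Ub₀ Rb₀j₀ = record { match = match ; match-edge = edge ; match-count = counts }
    where
    match : Fin m → Maybe (Fin q)
    match b = if does (b₀ ≟ b) then just j₀ else nothing
    edge : ∀ {b j} → match b ≡ just j → does (b₀ ≟ b) ∧ U b ≡ true × R b j ≡ true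
    edge {b} match≡ with b₀ ≟ b
    edge refl | yes refl = Ub₀ , Rb₀j₀
    edge ()   | no _
    hit : ∀ j b → 𝟙 (hits (match b) j) ≡ (if does (b₀ ≟ b) then 𝟙 (does (j₀ ≟ j)) else 0)
    hit j b with does (b₀ ≟ b)
    ... | true = refl
    ... | false = refl
    counts : ∀ j → count (λ b → hits (match b) j) ≡ 𝟙 (does (j₀ ≟ j))
    counts j = trans (sumℕ-cong (hit j)) (sumℕ-δ b₀ (λ _ → 𝟙 (does (j₀ ≟ j))))

  union : ∀ {U c c₁ c₂} (X : Fin m → Bool) → (∀ j → c j ≡ c₁ j ℕ.+ c₂ j) →
          Matching (λ b → X b ∧ U b) c₁ → Matching (λ b → not (X b) ∧ U b) c₂ → Matching U c
  union {U} {c} {c₁} {c₂} X c≡ M₁ M₂ = record { match = match ; match-edge = edge ; match-count = counts }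
    where
    module M₁ = Matching M₁
    module M₂ = Matching M₂
    match : Fin m → Maybe (Fin q)
    match b = if X b then M₁.match b else M₂.match b
    edge : ∀ {b j} → match b ≡ just j → U b ≡ true × R b j ≡ true
    edge {b} match≡ with X b in Xb
    ... | true = let XU , Rbj = M₁.match-edge match≡ in subst (λ x → x ∧ U b ≡ true) Xb XU , Rbj
    ... | false = let XU , Rbj = M₂.match-edge match≡ in subst (λ x → not x ∧ U b ≡ true) Xb XU , Rbj
    hit : ∀ j b → 𝟙 (hits (match b) j) ≡ 𝟙 (hits (M₁.match b) j) ℕ.+ 𝟙 (hits (M₂.match b) j)
    hit j b with X b in Xb
    ... | true rewrite M₂.unmatched (cong (λ x → not x ∧ U b) Xb) = sym (ℕP.+-identityʳ _)
    ... | false rewrite M₁.unmatched (cong (_∧ U b) Xb) = refl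
    counts : ∀ j → count (λ b → hits (match b) j) ≡ c j
    counts j = begin-equality
      count (λ b → hits (match b) j)  ≡⟨ sumℕ-cong (hit j) ⟩
      sumℕ (λ b → h₁ b ℕ.+ h₂ b)      ≡⟨ sumℕ-+ h₁ h₂ ⟩
      sumℕ h₁ ℕ.+ sumℕ h₂             ≡⟨ cong₂ ℕ._+_ (M₁.match-count j) (M₂.match-count j) ⟩
      c₁ j ℕ.+ c₂ j                   ≡⟨ c≡ j ⟨
      c j                             ∎
      where
      h₁ h₂ : Fin m → ℕ
      h₁ b = 𝟙 (hits (M₁.match b) j)
      h₂ b = 𝟙 (hits (M₂.match b) j)

  Tight : (Fin m → Bool) → (Fin q → ℕ) → (Fin q → Bool) → Set
  Tight U c J = 0 < demand c J × 0 < demand c (not ∘ J) × demand c J ≡ supply U J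

  demand-cong : ∀ c {J J′} → (∀ j → J j ≡ J′ j) → demand c J ≡ demand c J′
  demand-cong c J≗J′ = sumℕ-cong (λ j → cong (λ x → if x then c j else 0) (J≗J′ j))

  supply-cong : ∀ U {J J′} → (∀ j → J j ≡ J′ j) → supply U J ≡ supply U J′
  supply-cong U J≗J′ = sumℕ-cong (λ b → cong (λ x → 𝟙 (U b ∧ x)) (anyᵇ-cong (λ j → cong (_∧ R b j) (J≗J′ j))))

  Tight-cong : ∀ {U c J J′} → (∀ j → J j ≡ J′ j) → Tight U c J → Tight U c J′
  Tight-cong {U} {c} J≗J′ (0<dJ , 0<d¬J , dJ≡sJ) =
    subst (0 <_) (demand-cong c J≗J′) 0<dJ ,
    subst (0 <_) (demand-cong c (cong not ∘ J≗J′)) 0<d¬J ,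
    trans (sym (demand-cong c J≗J′)) (trans dJ≡sJ (supply-cong U J≗J′))

  tight? : ∀ U c → Dec (∃[ J ] Tight U c J)
  tight? U c = Dec.map′ (λ (J , t) → lookup J , t)
                        (λ (J , t) → tabulate J , Tight-cong (λ j → sym (lookup∘tabulate J j)) t)
                        (anySubset? (λ J → tight-dec (lookup J)))
    where
    tight-dec : ∀ J → Dec (Tight U c J)
    tight-dec J = (0 ℕ.<? demand c J) ×-dec (0 ℕ.<? demand c (not ∘ J)) ×-dec (demand c J ℕ.≟ supply U J)

  restrict-split : ∀ J c j → c j ≡ restrict J c j ℕ.+ restrict (not ∘ J) c j
  restrict-split J c j with J j
  ... | true = sym (ℕP.+-identityʳ (c j))
  ... | false = refl

  demand-∧ : ∀ c J J′ → demand (restrict J c) J′ ≡ demand c (λ j → J′ j ∧ J j)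
  demand-∧ c J J′ = sumℕ-cong pointwise
    where
    pointwise : ∀ j → restrict J′ (restrict J c) j ≡ restrict (λ j → J′ j ∧ J j) c j
    pointwise j with J′ j
    ... | true = refl
    ... | false = refl

  demand-∨ : ∀ c J J′ → demand c (λ j → J′ j ∨ J j) ≡ demand c J ℕ.+ demand (restrict (not ∘ J) c) J′
  demand-∨ c J J′ = trans (sumℕ-cong pointwise) (sumℕ-+ (restrict J c) (restrict J′ (restrict (not ∘ J) c)))
    where
    pointwise : ∀ j → restrict (λ j → J′ j ∨ J j) c j ≡ restrict J c j ℕ.+ restrict J′ (restrict (not ∘ J) c) j
    pointwise j with J′ j | J j
    ... | true  | true  = sym (ℕP.+-identityʳ (c j))
    ... | true  | false = refl
    ... | false | true  = sym (ℕP.+-identityʳ (c j))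
    ... | false | false = refl

  supply-∧ : ∀ U J J′ → supply U (λ j → J′ j ∧ J j) ≤ supply (λ b → neighbours J b ∧ U b) J′
  supply-∧ U J J′ = count-mono pointwise
    where
    pointwise : ∀ b → U b ∧ neighbours (λ j → J′ j ∧ J j) b ≡ true → (neighbours J b ∧ U b) ∧ neighbours J′ b ≡ true
    pointwise b UN with BoolP.∧-conicalˡ (U b) _ UN | BoolP.∧-conicalʳ (U b) _ UN
    ... | Ub | N = ∧-intro (∧-intro (anyᵇ-mono (λ j → via (λ J′J → BoolP.∧-conicalʳ (J′ j) _ J′J)) N) Ub)
                           (anyᵇ-mono (λ j → via (λ J′J → BoolP.∧-conicalˡ (J′ j) _ J′J)) N)
      where
      via : ∀ {x y r} → (x ≡ true → y ≡ true) → x ∧ r ≡ true → y ∧ r ≡ true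
      via {x} x⇒y xr = ∧-intro (x⇒y (BoolP.∧-conicalˡ x _ xr)) (BoolP.∧-conicalʳ x _ xr)

  𝟙-split : ∀ u x y → 𝟙 (u ∧ (y ∨ x)) ≡ 𝟙 (u ∧ x) ℕ.+ 𝟙 ((not x ∧ u) ∧ y)
  𝟙-split false false _ = refl
  𝟙-split false true  _ = refl
  𝟙-split true  false false = refl
  𝟙-split true  false true  = refl
  𝟙-split true  true  false = refl
  𝟙-split true  true  true  = refl

  supply-∨ : ∀ U J J′ → supply U (λ j → J′ j ∨ J j) ≡ supply U J ℕ.+ supply (λ b → not (neighbours J b) ∧ U b) J′
  supply-∨ U J J′ = trans (sumℕ-cong pointwise) (sumℕ-+ (λ b → 𝟙 (U b ∧ neighbours J b))
                                                         (λ b → 𝟙 ((not (neighbours J b) ∧ U b) ∧ neighbours J′ b)))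
    where
    neighbours-∨ : ∀ b → neighbours (λ j → J′ j ∨ J j) b ≡ neighbours J′ b ∨ neighbours J b
    neighbours-∨ b = trans (anyᵇ-cong (λ j → BoolP.∧-distribʳ-∨ (R b j) (J′ j) (J j)))
                           (anyᵇ-∨ (λ j → J′ j ∧ R b j) (λ j → J j ∧ R b j))
    pointwise : ∀ b → 𝟙 (U b ∧ neighbours (λ j → J′ j ∨ J j) b) ≡
                      𝟙 (U b ∧ neighbours J b) ℕ.+ 𝟙 ((not (neighbours J b) ∧ U b) ∧ neighbours J′ b)
    pointwise b = trans (cong (λ x → 𝟙 (U b ∧ x)) (neighbours-∨ b)) (𝟙-split (U b) _ _)

  demand-δ : ∀ c c′ j₀ → (∀ j → c j ≡ 𝟙 (does (j₀ ≟ j)) ℕ.+ c′ j) →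
             ∀ J → demand c J ≡ 𝟙 (J j₀) ℕ.+ demand c′ J
  demand-δ c c′ j₀ c≡ J = begin-equality
    demand c J                                        ≡⟨ sumℕ-cong split ⟩
    sumℕ (λ j → restrict J δ j ℕ.+ restrict J c′ j)  ≡⟨ sumℕ-+ (restrict J δ) (restrict J c′) ⟩
    demand δ J ℕ.+ demand c′ J                        ≡⟨ cong (ℕ._+ demand c′ J) (trans (sumℕ-cong δ-swap)
                                                                                         (sumℕ-δ j₀ (𝟙 ∘ J))) ⟩
    𝟙 (J j₀) ℕ.+ demand c′ J                          ∎
    where
    δ : Fin q → ℕ
    δ j = 𝟙 (does (j₀ ≟ j))
    split : ∀ j → restrict J c j ≡ restrict J δ j ℕ.+ restrict J c′ j
    split j with J j
    ... | true = c≡ j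
    ... | false = refl
    δ-swap : ∀ j → restrict J δ j ≡ (if does (j₀ ≟ j) then 𝟙 (J j) else 0)
    δ-swap j with J j | does (j₀ ≟ j)
    ... | true  | true  = refl
    ... | true  | false = refl
    ... | false | true  = refl
    ... | false | false = refl

  without : Fin m → (Fin m → Bool) → Fin m → Bool
  without b₀ U b = not (does (b₀ ≟ b)) ∧ U b

  supply-remove : ∀ U b₀ J → supply U J ≤ 1 ℕ.+ supply (without b₀ U) J
  supply-remove U b₀ J = begin
    supply U J                                  ≤⟨ sumℕ-mono-≤ pointwise ⟩
    sumℕ (λ b → at-b₀ b ℕ.+ rest b)             ≡⟨ sumℕ-+ at-b₀ rest ⟩
    sumℕ at-b₀ ℕ.+ supply (without b₀ U) J      ≡⟨ cong (ℕ._+ supply (without b₀ U) J) (sumℕ-δ b₀ (λ _ → 1)) ⟩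
    1 ℕ.+ supply (without b₀ U) J               ∎
    where
    at-b₀ rest : Fin m → ℕ
    at-b₀ b = 𝟙 (does (b₀ ≟ b))
    rest b = 𝟙 (without b₀ U b ∧ neighbours J b)
    pointwise : ∀ b → 𝟙 (U b ∧ neighbours J b) ≤ at-b₀ b ℕ.+ rest b
    pointwise b with does (b₀ ≟ b)
    ... | true = ℕP.≤-trans (𝟙≤1 _) (ℕP.m≤m+n 1 _)
    ... | false = ℕP.≤-refl

  SolvableBelow : (Fin q → ℕ) → Set
  SolvableBelow c = ∀ {U′ c′} → sumℕ c′ < sumℕ c → HallCondition U′ c′ → Matching U′ c′

  -- A tight J splits the problem into the rows adjacent to J with the demands on J, and the rest.
  split-tight : ∀ {U c} → SolvableBelow c → HallCondition U c → ∀ J → Tight U c J → Matching U c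
  split-tight {U} {c} rec hallUc J (0<dJ , 0<d¬J , dJ≡sJ) =
    union {U} (neighbours J) (restrict-split J c) (rec smaller-in hall-in) (rec smaller-out hall-out)
    where
    c-out : Fin q → ℕ
    c-out = restrict (not ∘ J) c
    U-in U-out : Fin m → Bool
    U-in b = neighbours J b ∧ U b
    U-out b = not (neighbours J b) ∧ U b
    total : sumℕ c ≡ demand c J ℕ.+ demand c (not ∘ J)
    total = trans (sumℕ-cong (restrict-split J c)) (sumℕ-+ (restrict J c) c-out)
    smaller-in : demand c J < sumℕ c
    smaller-in = subst (demand c J <_) (sym total) (ℕP.m<m+n (demand c J) 0<d¬J)
    smaller-out : demand c (not ∘ J) < sumℕ c
    smaller-out = subst (demand c (not ∘ J) <_) (sym total) (ℕP.m<n+m (demand c (not ∘ J)) 0<dJ)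
    hall-in : HallCondition U-in (restrict J c)
    hall-in J′ = begin
      demand (restrict J c) J′      ≡⟨ demand-∧ c J J′ ⟩
      demand c (λ j → J′ j ∧ J j)   ≤⟨ hallUc (λ j → J′ j ∧ J j) ⟩
      supply U (λ j → J′ j ∧ J j)   ≤⟨ supply-∧ U J J′ ⟩
      supply U-in J′                ∎
    hall-out : HallCondition U-out c-out
    hall-out J′ = ℕP.+-cancelˡ-≤ (demand c J) (demand c-out J′) (supply U-out J′) (begin
      demand c J ℕ.+ demand c-out J′  ≡⟨ demand-∨ c J J′ ⟨
      demand c (λ j → J′ j ∨ J j)     ≤⟨ hallUc (λ j → J′ j ∨ J j) ⟩
      supply U (λ j → J′ j ∨ J j)     ≡⟨ supply-∨ U J J′ ⟩
      supply U J ℕ.+ supply U-out J′  ≡⟨ cong (ℕ._+ supply U-out J′) dJ≡sJ ⟨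
      demand c J ℕ.+ supply U-out J′  ∎)

  adjacent-row : ∀ {U c j₀} → HallCondition U c → 0 < c j₀ → ∃[ b ] U b ≡ true × R b j₀ ≡ true
  adjacent-row {U} {c} {j₀} hallUc 0<cj₀ with count≢0 (λ b → U b ∧ neighbours J₀ b) supply≢0
    where
    J₀ : Fin q → Bool
    J₀ j = does (j₀ ≟ j)
    supply≢0 : supply U J₀ ≢ 0
    supply≢0 supply≡0 = ℕP.<⇒≢ (ℕP.<-≤-trans 0<cj₀ (subst (_≤ supply U J₀) (sumℕ-δ j₀ c) (hallUc J₀))) (sym supply≡0)
  ... | b , U∧N with anyᵇ-witness (λ j → does (j₀ ≟ j) ∧ R b j) (BoolP.∧-conicalʳ (U b) _ U∧N)
  ...   | j , j₀≟j∧R with j₀ ≟ j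
  ...     | yes refl = b , BoolP.∧-conicalˡ (U b) _ U∧N , j₀≟j∧R

  -- Without tight sets, removing a row b₀ and one unit of demand at j₀ keeps Hall's condition:
  -- sets J ∌ j₀ with positive demand were not tight, so they had a unit of supply to spare.
  remove-edge : ∀ {U c c′ b₀ j₀} → HallCondition U c → (∀ J → ¬ Tight U c J) → 0 < c j₀ →
                (∀ j → c j ≡ 𝟙 (does (j₀ ≟ j)) ℕ.+ c′ j) → HallCondition (without b₀ U) c′
  remove-edge {U} {c} {c′} {b₀} {j₀} hallUc no-tight 0<cj₀ c≡ J with J j₀ in Jj₀ | demand-δ c c′ j₀ c≡ J
  ... | true | dJ≡ = ℕP.+-cancelˡ-≤ 1 (demand c′ J) (supply (without b₀ U) J) (begin
    1 ℕ.+ demand c′ J  ≡⟨ dJ≡ ⟨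
    demand c J         ≤⟨ hallUc J ⟩
    supply U J         ≤⟨ supply-remove U b₀ J ⟩
    1 ℕ.+ supply (without b₀ U) J  ∎)
  ... | false | dJ≡ with demand c J ℕ.≟ 0
  ...   | yes dJ≡0 = subst (_≤ supply (without b₀ U) J) (trans (sym dJ≡0) dJ≡) ℕ.z≤n
  ...   | no dJ≢0 = ℕP.≤-pred (begin
    suc (demand c′ J)   ≡⟨ cong suc dJ≡ ⟨
    suc (demand c J)    ≤⟨ ℕP.≤∧≢⇒< (hallUc J) (λ dJ≡sJ → no-tight J (ℕP.n≢0⇒n>0 dJ≢0 , 0<d¬J , dJ≡sJ)) ⟩
    supply U J          ≤⟨ supply-remove U b₀ J ⟩
    1 ℕ.+ supply (without b₀ U) J   ∎)
    where
    0<d¬J : 0 < demand c (not ∘ J)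
    0<d¬J = ℕP.<-≤-trans 0<cj₀ (subst (_≤ demand c (not ∘ J)) (cong (λ x → if not x then c j₀ else 0) Jj₀)
                                      (term≤sumℕ (restrict (not ∘ J) c) j₀))

  peel : ∀ {U c} → SolvableBelow c → HallCondition U c → (∀ J → ¬ Tight U c J) → sumℕ c ≢ 0 → Matching U c
  peel {U} {c} rec hallUc no-tight Σc≢0 =
    union {U} (λ b → does (b₀ ≟ b)) c≡δ+c′ (edge-matching {U} Ub₀ Rb₀j₀)
          (rec smaller (remove-edge {b₀ = b₀} hallUc no-tight 0<cj₀ c≡δ+c′))
    where
    j₀ : Fin q
    j₀ = proj₁ (sumℕ≢0 c Σc≢0)
    0<cj₀ : 0 < c j₀
    0<cj₀ = proj₂ (sumℕ≢0 c Σc≢0)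
    b₀ : Fin m
    b₀ = proj₁ (adjacent-row hallUc 0<cj₀)
    Ub₀ : U b₀ ≡ true
    Ub₀ = proj₁ (proj₂ (adjacent-row hallUc 0<cj₀))
    Rb₀j₀ : R b₀ j₀ ≡ true
    Rb₀j₀ = proj₂ (proj₂ (adjacent-row hallUc 0<cj₀))
    δ c′ : Fin q → ℕ
    δ j = 𝟙 (does (j₀ ≟ j))
    c′ j = c j ℕ.∸ δ j
    δ≤c : ∀ j → δ j ≤ c j
    δ≤c j with j₀ ≟ j
    ... | yes refl = 0<cj₀
    ... | no _ = ℕ.z≤n
    c≡δ+c′ : ∀ j → c j ≡ δ j ℕ.+ c′ j
    c≡δ+c′ j = sym (ℕP.m+[n∸m]≡n (δ≤c j))
    smaller : sumℕ c′ < sumℕ c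
    smaller = subst (sumℕ c′ <_) (sym Σc≡1+Σc′) (ℕP.n<1+n (sumℕ c′))
      where
      Σc≡1+Σc′ : sumℕ c ≡ 1 ℕ.+ sumℕ c′
      Σc≡1+Σc′ = trans (sumℕ-cong c≡δ+c′) (trans (sumℕ-+ δ c′) (cong (ℕ._+ sumℕ c′) (sumℕ-δ j₀ (λ _ → 1))))

  hall : ∀ U c → HallCondition U c → Matching U c
  hall U c = <-rec (λ N → ∀ {U c} → sumℕ c ≡ N → HallCondition U c → Matching U c) step (sumℕ c) refl
    where
    step : ∀ N → (∀ {N′} → N′ < N → ∀ {U c} → sumℕ c ≡ N′ → HallCondition U c → Matching U c) →
           ∀ {U c} → sumℕ c ≡ N → HallCondition U c → Matching U c
    step _ ih {U} {c} refl hallUc = by-cases (sumℕ c ℕ.≟ 0) (tight? U c)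
      where
      rec : SolvableBelow c
      rec lt = ih lt refl
      by-cases : Dec (sumℕ c ≡ 0) → Dec (∃[ J ] Tight U c J) → Matching U c
      by-cases (yes Σc≡0) _ = empty-matching (sumℕ≡0 c Σc≡0)
      by-cases (no _) (yes (J , tight)) = split-tight rec hallUc J tight
      by-cases (no Σc≢0) (no ¬tight) = peel rec hallUc (λ J tight → ¬tight (J , tight)) Σc≢0

open ≡-Reasoning

0≤1 : 0ℚ ℚ.≤ 1ℚ
0≤1 = ℚP.<⇒≤ (ℚP.positive⁻¹ 1ℚ)

*-nonNeg : ∀ {p q} → 0ℚ ℚ.≤ p → 0ℚ ℚ.≤ q → 0ℚ ℚ.≤ p * q
*-nonNeg {p} {q} 0≤p 0≤q =
  ℚP.nonNegative⁻¹ (p * q) {{ℚP.nonNeg*nonNeg⇒nonNeg p {{ℚ.nonNegative 0≤p}} q {{ℚ.nonNegative 0≤q}}}}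

≤⇒0≤- : ∀ {p q} → p ℚ.≤ q → 0ℚ ℚ.≤ q - p
≤⇒0≤- {p} {q} p≤q = subst (ℚ._≤ q - p) (ℚP.+-inverseʳ p) (ℚP.+-monoˡ-≤ (- p) p≤q)

<⇒0<- : ∀ {p q} → p ℚ.< q → 0ℚ ℚ.< q - p
<⇒0<- {p} {q} p<q = subst (ℚ._< q - p) (ℚP.+-inverseʳ p) (ℚP.+-monoˡ-< (- p) p<q)

nonNeg+nonNeg≡0 : ∀ {p q} → 0ℚ ℚ.≤ p → 0ℚ ℚ.≤ q → p + q ≡ 0ℚ → p ≡ 0ℚ × q ≡ 0ℚ
nonNeg+nonNeg≡0 {p} {q} 0≤p 0≤q p+q≡0 =
  ℚP.≤-antisym (subst₂ ℚ._≤_ (ℚP.+-identityʳ p) p+q≡0 (ℚP.+-monoʳ-≤ p 0≤q)) 0≤p ,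
  ℚP.≤-antisym (subst₂ ℚ._≤_ (ℚP.+-identityˡ q) p+q≡0 (ℚP.+-monoˡ-≤ q 0≤p)) 0≤q

≤∧≢⇒< : ∀ {p q} → p ℚ.≤ q → p ≢ q → p ℚ.< q
≤∧≢⇒< {p} {q} p≤q p≢q with ℚP.<-cmp p q
... | tri< p<q _ _ = p<q
... | tri≈ _ p≡q _ = ⊥-elim (p≢q p≡q)
... | tri> _ _ q<p = ⊥-elim (ℚP.<-irrefl refl (ℚP.≤-<-trans p≤q q<p))

*-monoˡ-≤ : ∀ {l p q} → 0ℚ ℚ.≤ l → p ℚ.≤ q → l * p ℚ.≤ l * q
*-monoˡ-≤ {l} 0≤l = ℚP.*-monoˡ-≤-nonNeg l {{ℚ.nonNegative 0≤l}}

p+[q-p]≡q : ∀ p q → p + (q - p) ≡ q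
p+[q-p]≡q p q = begin
  p + (q - p)     ≡⟨ cong (p +_) (ℚP.+-comm q (- p)) ⟩
  p + (- p + q)   ≡⟨ ℚP.+-assoc p (- p) q ⟨
  (p - p) + q     ≡⟨ cong (_+ q) (ℚP.+-inverseʳ p) ⟩
  0ℚ + q          ≡⟨ ℚP.+-identityˡ q ⟩
  q               ∎

+-pinned : ∀ {a b c d} → a ℚ.≤ c → b ℚ.≤ d → a + b ≡ c + d → a ≡ c × b ≡ d
+-pinned {a} {b} {c} {d} a≤c b≤d sum≡ =
  ℚP.≤-antisym a≤c (ℚP.≮⇒≥ (λ a<c → ℚP.<⇒≢ (ℚP.+-mono-<-≤ a<c b≤d) sum≡)) ,
  ℚP.≤-antisym b≤d (ℚP.≮⇒≥ (λ b<d → ℚP.<⇒≢ (ℚP.+-mono-≤-< a≤c b<d) sum≡))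

*-cancelˡ-pos : ∀ {l p q} → 0ℚ ℚ.< l → l * p ≡ l * q → p ≡ q
*-cancelˡ-pos {l} 0<l lp≡lq = ℚP.≤-antisym (cancel (ℚP.≤-reflexive lp≡lq)) (cancel (ℚP.≤-reflexive (sym lp≡lq)))
  where
  cancel : ∀ {p q} → l * p ℚ.≤ l * q → p ℚ.≤ q
  cancel = ℚP.*-cancelˡ-≤-pos l {{ℚ.positive 0<l}}

pos*≡0 : ∀ {l p} → 0ℚ ℚ.< l → l * p ≡ 0ℚ → p ≡ 0ℚ
pos*≡0 {l} 0<l lp≡0 = *-cancelˡ-pos 0<l (trans lp≡0 (sym (ℚP.*-zeroʳ l)))

sumFin≡sum : ∀ {k} (f : Fin k → ℚ) → sumFin f ≡ sum f
sumFin≡sum {zero} f = refl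
sumFin≡sum {suc k} f = cong (f zero +_) (sumFin≡sum (λ i → f (suc i)))

sum-zero : ∀ k → ∑[ i < k ] 0ℚ ≡ 0ℚ
sum-zero = sum-replicate-zero

sum-nonNeg : ∀ {k} {f : Fin k → ℚ} → (∀ i → 0ℚ ℚ.≤ f i) → 0ℚ ℚ.≤ sum f
sum-nonNeg {zero} _ = ℚP.≤-refl
sum-nonNeg {suc k} 0≤f = ℚP.+-mono-≤ (0≤f zero) (sum-nonNeg (λ i → 0≤f (suc i)))

sum-mono-≤ : ∀ {k} {f g : Fin k → ℚ} → (∀ i → f i ℚ.≤ g i) → sum f ℚ.≤ sum g
sum-mono-≤ {zero} _ = ℚP.≤-refl
sum-mono-≤ {suc k} f≤g = ℚP.+-mono-≤ (f≤g zero) (sum-mono-≤ (λ i → f≤g (suc i)))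

sum-nonNeg≡0 : ∀ {k} {f : Fin k → ℚ} → (∀ i → 0ℚ ℚ.≤ f i) → sum f ≡ 0ℚ → ∀ i → f i ≡ 0ℚ
sum-nonNeg≡0 {suc k} 0≤f Σf≡0 i with nonNeg+nonNeg≡0 (0≤f zero) (sum-nonNeg (λ i → 0≤f (suc i))) Σf≡0
sum-nonNeg≡0 {suc k} 0≤f Σf≡0 zero    | f₀≡0 , _ = f₀≡0
sum-nonNeg≡0 {suc k} 0≤f Σf≡0 (suc i) | _ , Σ≡0 = sum-nonNeg≡0 (λ i → 0≤f (suc i)) Σ≡0 i

sum≢0 : ∀ {k} (f : Fin k → ℚ) → sum f ≢ 0ℚ → ∃[ i ] f i ≢ 0ℚ
sum≢0 {zero} f Σf≢0 = ⊥-elim (Σf≢0 refl)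
sum≢0 {suc k} f Σf≢0 with f zero ℚP.≟ 0ℚ
... | no f₀≢0 = zero , f₀≢0
... | yes f₀≡0 with sum≢0 (λ i → f (suc i)) (λ Σ≡0 → Σf≢0 (cong₂ _+_ f₀≡0 Σ≡0))
...   | i , fᵢ≢0 = suc i , fᵢ≢0

-- ℕtoℚ k normalises k/1, which does not compute for a variable k; k/1 below is its normal form.
k/1 : ℕ → ℚ
k/1 k = mkℚ (ℤ.+ k) 0 (Coprime.sym (Coprime.1-coprimeTo k))

ℕtoℚ≡k/1 : ∀ k → ℕtoℚ k ≡ k/1 k
ℕtoℚ≡k/1 k = ℚP.↥p/↧p≡p (k/1 k)

ℕtoℚ-+ : ∀ k l → ℕtoℚ (k ℕ.+ l) ≡ ℕtoℚ k + ℕtoℚ l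
ℕtoℚ-+ k l = sym (begin
  ℕtoℚ k + ℕtoℚ l                        ≡⟨ cong₂ _+_ (ℕtoℚ≡k/1 k) (ℕtoℚ≡k/1 l) ⟩
  k/1 k + k/1 l                          ≡⟨ cong₂ (λ x y → (x ℤ.+ y) ℚ./ 1)
                                                    (ℤP.*-identityʳ (ℤ.+ k)) (ℤP.*-identityʳ (ℤ.+ l)) ⟩
  ℕtoℚ (k ℕ.+ l)                         ∎)

ℕtoℚ-cancel-≤ : ∀ {k l} → ℕtoℚ k ℚ.≤ ℕtoℚ l → k ≤ l
ℕtoℚ-cancel-≤ {k} {l} k≤l with subst₂ ℚ._≤_ (ℕtoℚ≡k/1 k) (ℕtoℚ≡k/1 l) k≤l
... | ℚ.*≤* k*1≤l*1 = ℤP.drop‿+≤+ (subst₂ ℤ._≤_ (ℤP.*-identityʳ (ℤ.+ k)) (ℤP.*-identityʳ (ℤ.+ l)) k*1≤l*1)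

ℕtoℚ-injective : ∀ {k l} → ℕtoℚ k ≡ ℕtoℚ l → k ≡ l
ℕtoℚ-injective k≡l =
  ℕP.≤-antisym (ℕtoℚ-cancel-≤ (ℚP.≤-reflexive k≡l)) (ℕtoℚ-cancel-≤ (ℚP.≤-reflexive (sym k≡l)))

Pair : ℕ → Set
Pair n = Σ (Fin n × Fin n) (λ p → proj₁ p <ᶠ proj₂ p)

-- The summand of sumPairs is local to its definition; unification recovers it.
pairSummand : ∀ {n} → (Pair n → ℚ) → Fin n → Fin n → ℚ
pairSummand f = summand (refl {x = sumPairs f})
  where
  summand : ∀ {n s} {g : Fin n → Fin n → ℚ} → s ≡ sumFin (λ i → sumFin (g i)) → Fin n → Fin n → ℚ
  summand {g = g} _ = g

pairSummand-cong : ∀ {n} {f g : Pair n → ℚ} → (∀ p → f p ≡ g p) → ∀ i j → pairSummand f i j ≡ pairSummand g i j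
pairSummand-cong f≗g i j with i FinP.<? j
... | yes _ = f≗g _
... | no _ = refl

pairSummand-zero : ∀ {n} (i j : Fin n) → pairSummand (λ _ → 0ℚ) i j ≡ 0ℚ
pairSummand-zero i j with i FinP.<? j
... | yes _ = refl
... | no _ = refl

pairSummand-linear : ∀ {n} l (u v : Pair n → ℚ) i j →
  pairSummand (λ p → l * u p + v p) i j ≡ l * pairSummand u i j + pairSummand v i j
pairSummand-linear l u v i j with i FinP.<? j
... | yes _ = refl
... | no _ = sym (cong (_+ 0ℚ) (ℚP.*-zeroʳ l))

∑-linear : ∀ {k} l (u v : Fin k → ℚ) → ∑[ i < k ] (l * u i + v i) ≡ l * sum u + sum v
∑-linear l u v = trans (∑-distrib-+ (λ i → l * u i) v) (cong (_+ sum v) (sym (*-distribˡ-sum l u)))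

∑ᵖ : ∀ {n} → (Pair n → ℚ) → ℚ
∑ᵖ {n} f = ∑[ i < n ] ∑[ j < n ] pairSummand f i j

sumPairs≡∑ᵖ : ∀ {n} (f : Pair n → ℚ) → sumPairs f ≡ ∑ᵖ f
sumPairs≡∑ᵖ f = trans (sumFin≡sum (λ i → sumFin (pairSummand f i))) (sum-cong-≗ (λ i → sumFin≡sum (pairSummand f i)))

∑ᵖ-cong : ∀ {n} {f g : Pair n → ℚ} → (∀ p → f p ≡ g p) → ∑ᵖ f ≡ ∑ᵖ g
∑ᵖ-cong f≗g = sum-cong-≗ (λ i → sum-cong-≗ (pairSummand-cong f≗g i))

∑ᵖ-zero : ∀ {n} → ∑ᵖ {n} (λ _ → 0ℚ) ≡ 0ℚ
∑ᵖ-zero {n} = trans (sum-cong-≗ row) (sum-zero n)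
  where
  row : ∀ i → ∑[ j < n ] pairSummand (λ _ → 0ℚ) i j ≡ 0ℚ
  row i = trans (sum-cong-≗ (pairSummand-zero i)) (sum-zero n)

∑ᵖ-linear : ∀ {n} l (f g : Pair n → ℚ) → ∑ᵖ (λ p → l * f p + g p) ≡ l * ∑ᵖ f + ∑ᵖ g
∑ᵖ-linear {n} l f g = trans (sum-cong-≗ row) (∑-linear l (λ i → sum (pairSummand f i)) (λ i → sum (pairSummand g i)))
  where
  row : ∀ i → ∑[ j < n ] pairSummand (λ p → l * f p + g p) i j ≡ l * sum (pairSummand f i) + sum (pairSummand g i)
  row i = trans (sum-cong-≗ (pairSummand-linear l f g i)) (∑-linear l (pairSummand f i) (pairSummand g i))

∑ᵈ : ∀ {n} → Vec n → ℚ
∑ᵈ {n} x = ∑[ i < n ] x (inj₁ i) + ∑ᵖ (x ∘ inj₂)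

dot≡∑ᵈ : ∀ {n} (c x : Vec n) → dot c x ≡ ∑ᵈ (λ k → c k * x k)
dot≡∑ᵈ c x = cong₂ _+_ (sumFin≡sum (λ i → c (inj₁ i) * x (inj₁ i))) (sumPairs≡∑ᵖ (λ p → c (inj₂ p) * x (inj₂ p)))

∑ᵈ-cong : ∀ {n} {x y : Vec n} → (∀ k → x k ≡ y k) → ∑ᵈ x ≡ ∑ᵈ y
∑ᵈ-cong x≗y = cong₂ _+_ (sum-cong-≗ (x≗y ∘ inj₁)) (∑ᵖ-cong (x≗y ∘ inj₂))

∑ᵈ-zero : ∀ {n} → ∑ᵈ {n} (λ _ → 0ℚ) ≡ 0ℚ
∑ᵈ-zero {n} = cong₂ _+_ (sum-zero n) (∑ᵖ-zero {n})

∑ᵈ-linear : ∀ {n} l (x y : Vec n) → ∑ᵈ (λ k → l * x k + y k) ≡ l * ∑ᵈ x + ∑ᵈ y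
∑ᵈ-linear l x y = trans (cong₂ _+_ (∑-linear l (x ∘ inj₁) (y ∘ inj₁)) (∑ᵖ-linear l (x ∘ inj₂) (y ∘ inj₂)))
                        (regroup l (sum (x ∘ inj₁)) (sum (y ∘ inj₁)) (∑ᵖ (x ∘ inj₂)) (∑ᵖ (y ∘ inj₂)))
  where
  regroup : ∀ l a b c d → (l * a + b) + (l * c + d) ≡ l * (a + c) + (b + d)
  regroup = solve 5 (λ l a b c d → (l :* a :+ b) :+ (l :* c :+ d) := l :* (a :+ c) :+ (b :+ d)) refl

dot-cong : ∀ {n} (c : Vec n) {x y : Vec n} → (∀ k → x k ≡ y k) → dot c x ≡ dot c y
dot-cong c {x} {y} x≗y = begin
  dot c x                 ≡⟨ dot≡∑ᵈ c x ⟩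
  ∑ᵈ (λ k → c k * x k)    ≡⟨ ∑ᵈ-cong (λ k → cong (c k *_) (x≗y k)) ⟩
  ∑ᵈ (λ k → c k * y k)    ≡⟨ dot≡∑ᵈ c y ⟨
  dot c y                 ∎

dot-zero : ∀ {n} (c : Vec n) → dot c (λ _ → 0ℚ) ≡ 0ℚ
dot-zero {n} c = begin
  dot c (λ _ → 0ℚ)        ≡⟨ dot≡∑ᵈ c (λ _ → 0ℚ) ⟩
  ∑ᵈ (λ k → c k * 0ℚ)     ≡⟨ ∑ᵈ-cong (λ k → ℚP.*-zeroʳ (c k)) ⟩
  ∑ᵈ {n} (λ _ → 0ℚ)       ≡⟨ ∑ᵈ-zero {n} ⟩
  0ℚ                      ∎

dot-linear : ∀ {n} (c : Vec n) l (x y : Vec n) → dot c (λ k → l * x k + y k) ≡ l * dot c x + dot c y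
dot-linear c l x y = begin
  dot c (λ k → l * x k + y k)                     ≡⟨ dot≡∑ᵈ c (λ k → l * x k + y k) ⟩
  ∑ᵈ (λ k → c k * (l * x k + y k))                ≡⟨ ∑ᵈ-cong (λ k → distribute (c k) (x k) (y k)) ⟩
  ∑ᵈ (λ k → l * (c k * x k) + c k * y k)          ≡⟨ ∑ᵈ-linear l (λ k → c k * x k) (λ k → c k * y k) ⟩
  l * ∑ᵈ (λ k → c k * x k) + ∑ᵈ (λ k → c k * y k) ≡⟨ cong₂ (λ s t → l * s + t) (dot≡∑ᵈ c x) (dot≡∑ᵈ c y) ⟨
  l * dot c x + dot c y                           ∎
  where
  distribute : ∀ c x y → c * (l * x + y) ≡ l * (c * x) + c * y
  distribute c x y = solve 4 (λ l c x y → c :* (l :* x :+ y) := l :* (c :* x) :+ c :* y) refl l c x y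

module _ {A : Set} where

  integral : List (ℚ × A) → (A → ℚ) → ℚ
  integral [] φ = 0ℚ
  integral ((l , x) ∷ ws) φ = l * φ x + integral ws φ

  NonNegWeights : List (ℚ × A) → Set
  NonNegWeights = All (λ w → 0ℚ ℚ.≤ proj₁ w)

  _∈supp_ : A → List (ℚ × A) → Set
  x ∈supp ws = ∃[ l ] ((l , x) ∈ ws × 0ℚ ℚ.< l)

  integral-cong : ∀ ws {φ ψ : A → ℚ} → (∀ x → φ x ≡ ψ x) → integral ws φ ≡ integral ws ψ
  integral-cong [] φ≗ψ = refl
  integral-cong ((l , x) ∷ ws) φ≗ψ = cong₂ _+_ (cong (l *_) (φ≗ψ x)) (integral-cong ws φ≗ψ)

  integral-+ : ∀ ws (φ ψ : A → ℚ) → integral ws (λ x → φ x + ψ x) ≡ integral ws φ + integral ws ψ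
  integral-+ [] φ ψ = refl
  integral-+ ((l , x) ∷ ws) φ ψ = begin
    l * (φ x + ψ x) + integral ws (λ x → φ x + ψ x)  ≡⟨ cong (l * (φ x + ψ x) +_) (integral-+ ws φ ψ) ⟩
    l * (φ x + ψ x) + (Iφ + Iψ)                      ≡⟨ regroup l (φ x) (ψ x) Iφ Iψ ⟩
    (l * φ x + Iφ) + (l * ψ x + Iψ)                  ∎
    where
    Iφ Iψ : ℚ
    Iφ = integral ws φ
    Iψ = integral ws ψ
    regroup : ∀ l a b c d → l * (a + b) + (c + d) ≡ (l * a + c) + (l * b + d)
    regroup = solve 5 (λ l a b c d → l :* (a :+ b) :+ (c :+ d) := (l :* a :+ c) :+ (l :* b :+ d)) refl

  integral-∑ : ∀ {k} ws (f : Fin k → A → ℚ) → integral ws (λ x → ∑[ j < k ] f j x) ≡ ∑[ j < k ] integral ws (f j)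
  integral-∑ {k} [] f = sym (sum-zero k)
  integral-∑ {k} ((l , x) ∷ ws) f = begin
    l * ∑[ j < k ] f j x + integral ws (λ x → ∑[ j < k ] f j x)  ≡⟨ cong (l * _ +_) (integral-∑ ws f) ⟩
    l * ∑[ j < k ] f j x + ∑[ j < k ] integral ws (f j)          ≡⟨ ∑-linear l (λ j → f j x) (λ j → integral ws (f j)) ⟨
    ∑[ j < k ] (l * f j x + integral ws (f j))                   ∎

  integral-nonNeg : ∀ {ws φ} → NonNegWeights ws → (∀ x → 0ℚ ℚ.≤ φ x) → 0ℚ ℚ.≤ integral ws φ
  integral-nonNeg [] 0≤φ = ℚP.≤-refl
  integral-nonNeg {(_ , x) ∷ _} (0≤l ∷ 0≤ws) 0≤φ = ℚP.+-mono-≤ (*-nonNeg 0≤l (0≤φ x)) (integral-nonNeg 0≤ws 0≤φ)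

  integral-mono-≤ : ∀ {ws φ ψ} → NonNegWeights ws → (∀ x → φ x ℚ.≤ ψ x) → integral ws φ ℚ.≤ integral ws ψ
  integral-mono-≤ [] φ≤ψ = ℚP.≤-refl
  integral-mono-≤ {(l , x) ∷ _} (0≤l ∷ 0≤ws) φ≤ψ =
    ℚP.+-mono-≤ (*-monoˡ-≤ 0≤l (φ≤ψ x)) (integral-mono-≤ 0≤ws φ≤ψ)

  integral≡0 : ∀ {ws φ} → NonNegWeights ws → (∀ x → 0ℚ ℚ.≤ φ x) → integral ws φ ≡ 0ℚ →
               ∀ {x} → x ∈supp ws → φ x ≡ 0ℚ
  integral≡0 {(l , y) ∷ _} (0≤l ∷ 0≤ws) 0≤φ I≡0 (_ , here refl , 0<l) =
    pos*≡0 0<l (proj₁ (nonNeg+nonNeg≡0 (*-nonNeg 0≤l (0≤φ y)) (integral-nonNeg 0≤ws 0≤φ) I≡0))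
  integral≡0 {(l , y) ∷ _} (0≤l ∷ 0≤ws) 0≤φ I≡0 (_ , there x∈ws , 0<l′) =
    integral≡0 0≤ws 0≤φ (proj₂ (nonNeg+nonNeg≡0 (*-nonNeg 0≤l (0≤φ y)) (integral-nonNeg 0≤ws 0≤φ) I≡0)) (_ , x∈ws , 0<l′)

  integral≢0 : ∀ {ws φ} → NonNegWeights ws → integral ws φ ≢ 0ℚ → ∃[ x ] (x ∈supp ws × φ x ≢ 0ℚ)
  integral≢0 {[]} [] I≢0 = ⊥-elim (I≢0 refl)
  integral≢0 {(l , x) ∷ ws} {φ} (0≤l ∷ 0≤ws) I≢0 with l * φ x ℚP.≟ 0ℚ
  ... | no lφ≢0 = x , (l , here refl , ≤∧≢⇒< 0≤l (λ 0≡l → lφ≢0 (trans (cong (_* φ x) (sym 0≡l)) (ℚP.*-zeroˡ (φ x))))) ,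
                  (λ φ≡0 → lφ≢0 (trans (cong (l *_) φ≡0) (ℚP.*-zeroʳ l)))
  ... | yes lφ≡0 with integral≢0 0≤ws (λ I≡0 → I≢0 (cong₂ _+_ lφ≡0 I≡0))
  ...   | y , (l′ , y∈ws , 0<l′) , φy≢0 = y , (l′ , there y∈ws , 0<l′) , φy≢0

  integral-cong-supp : ∀ {ws φ ψ} → NonNegWeights ws → (∀ {x} → x ∈supp ws → φ x ≡ ψ x) →
                       integral ws φ ≡ integral ws ψ
  integral-cong-supp [] _ = refl
  integral-cong-supp {(l , x) ∷ ws} {φ} {ψ} (0≤l ∷ 0≤ws) φ≗ψ =
    cong₂ _+_ first-term (integral-cong-supp 0≤ws (λ (l′ , x∈ws , 0<l′) → φ≗ψ (l′ , there x∈ws , 0<l′)))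
    where
    first-term : l * φ x ≡ l * ψ x
    first-term with ℚP.<-cmp 0ℚ l
    ... | tri< 0<l _ _ = cong (l *_) (φ≗ψ (l , here refl , 0<l))
    ... | tri≈ _ 0≡l _ = begin
      l * φ x   ≡⟨ cong (_* φ x) (sym 0≡l) ⟩
      0ℚ * φ x  ≡⟨ ℚP.*-zeroˡ (φ x) ⟩
      0ℚ        ≡⟨ ℚP.*-zeroˡ (ψ x) ⟨
      0ℚ * ψ x  ≡⟨ cong (_* ψ x) 0≡l ⟩
      l * ψ x   ∎
    ... | tri> _ _ l<0 = ⊥-elim (ℚP.<-irrefl refl (ℚP.≤-<-trans 0≤l l<0))

integral-const : ∀ {n} (ws : List (ℚ × Subset n)) q → integral ws (λ _ → q) ≡ weightSum ws * q
integral-const [] q = sym (ℚP.*-zeroˡ q)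
integral-const ((l , _) ∷ ws) q =
  trans (cong (l * q +_) (integral-const ws q)) (sym (ℚP.*-distribʳ-+ q l (weightSum ws)))

combo≡integral : ∀ {n} (ws : List (ℚ × Subset n)) k → combo ws k ≡ integral ws (λ S → aS S k)
combo≡integral [] k = refl
combo≡integral ((l , S) ∷ ws) k = cong (l * aS S k +_) (combo≡integral ws k)

dot-combo : ∀ {n} (c : Vec n) ws → dot c (combo ws) ≡ integral ws (λ S → dot c (aS S))
dot-combo c [] = dot-zero c
dot-combo c ((l , S) ∷ ws) = trans (dot-linear c l (aS S) (combo ws)) (cong (l * dot c (aS S) +_) (dot-combo c ws))

-- Vertices of faces

b2q-01 : ∀ x → b2q x ≡ 0ℚ ⊎ b2q x ≡ 1ℚ
b2q-01 false = inj₁ refl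
b2q-01 true = inj₂ refl

b2q-nonNeg : ∀ x → 0ℚ ℚ.≤ b2q x
b2q-nonNeg false = ℚP.≤-refl
b2q-nonNeg true = 0≤1

b2q-bounded : ∀ x → 0ℚ ℚ.≤ b2q x × b2q x ℚ.≤ 1ℚ
b2q-bounded false = b2q-nonNeg false , 0≤1
b2q-bounded true = b2q-nonNeg true , ℚP.≤-refl

aS-01 : ∀ {n} (S : Subset n) k → aS S k ≡ 0ℚ ⊎ aS S k ≡ 1ℚ
aS-01 S (inj₁ i) = b2q-01 (S i)
aS-01 S (inj₂ ((i , j) , _)) = b2q-01 (S i ∧ S j)

aS-bounded : ∀ {n} (S : Subset n) k → 0ℚ ℚ.≤ aS S k × aS S k ℚ.≤ 1ℚ
aS-bounded S (inj₁ i) = b2q-bounded (S i)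
aS-bounded S (inj₂ ((i , j) , _)) = b2q-bounded (S i ∧ S j)

aS∈P : ∀ {n} (S : Subset n) → InP (aS S)
aS∈P S = (1ℚ , S) ∷ [] , 0≤1 ∷ [] , refl , λ k → sym (trans (ℚP.+-identityʳ _) (ℚP.*-identityˡ _))

P-bounded : ∀ {n} {x : Vec n} → InP x → ∀ k → 0ℚ ℚ.≤ x k × x k ℚ.≤ 1ℚ
P-bounded (ws , 0≤ws , total , x≡) k rewrite x≡ k | combo≡integral ws k =
  integral-nonNeg 0≤ws (λ S → proj₁ (aS-bounded S k)) ,
  ℚP.≤-trans (integral-mono-≤ 0≤ws (λ S → proj₂ (aS-bounded S k)))
             (ℚP.≤-reflexive (trans (integral-const ws 1ℚ) (cong (_* 1ℚ) total)))

-- v = l v + (1 - l) v, and y, z lie on the same side of v ∈ {0, 1}: +-pinned forces y = z = v.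
01-extreme : ∀ {l y z v} → 0ℚ ℚ.< l → l ℚ.< 1ℚ → 0ℚ ℚ.≤ y × y ℚ.≤ 1ℚ → 0ℚ ℚ.≤ z × z ℚ.≤ 1ℚ →
             v ≡ 0ℚ ⊎ v ≡ 1ℚ → v ≡ l * y + (1ℚ - l) * z → y ≡ z
01-extreme {l} {y} {z} 0<l l<1 (0≤y , _) (0≤z , _) (inj₁ refl) 0≡ =
  trans (sym (*-cancelˡ-pos 0<l (proj₁ pinned))) (*-cancelˡ-pos (<⇒0<- l<1) (proj₂ pinned))
  where
  pinned : l * 0ℚ ≡ l * y × (1ℚ - l) * 0ℚ ≡ (1ℚ - l) * z
  pinned = +-pinned (*-monoˡ-≤ (ℚP.<⇒≤ 0<l) 0≤y) (*-monoˡ-≤ (ℚP.<⇒≤ (<⇒0<- l<1)) 0≤z)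
                    (trans (cong₂ _+_ (ℚP.*-zeroʳ l) (ℚP.*-zeroʳ (1ℚ - l))) 0≡)
01-extreme {l} {y} {z} 0<l l<1 (_ , y≤1) (_ , z≤1) (inj₂ refl) 1≡ =
  trans (*-cancelˡ-pos 0<l (proj₁ pinned)) (sym (*-cancelˡ-pos (<⇒0<- l<1) (proj₂ pinned)))
  where
  pinned : l * y ≡ l * 1ℚ × (1ℚ - l) * z ≡ (1ℚ - l) * 1ℚ
  pinned = +-pinned (*-monoˡ-≤ (ℚP.<⇒≤ 0<l) y≤1) (*-monoˡ-≤ (ℚP.<⇒≤ (<⇒0<- l<1)) z≤1)
                    (trans (sym 1≡) (sym (trans (cong₂ _+_ (ℚP.*-identityʳ l) (ℚP.*-identityʳ (1ℚ - l))) (p+[q-p]≡q l 1ℚ))))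

aS-vertex : ∀ {n} (F : Face n) (S : Subset n) → dot (Face.c F) (aS S) ≡ Face.δ F → IsVertex F (aS S)
aS-vertex F S onF = (aS∈P S , onF) , λ y z l (y∈P , _) (z∈P , _) 0<l l<1 aS≡ k →
  01-extreme 0<l l<1 (P-bounded y∈P k) (P-bounded z∈P k) (aS-01 S k) (aS≡ k)

supp⊆face : ∀ {n} (F : Face n) {ws : List (ℚ × Subset n)} → NonNegWeights ws → weightSum ws ≡ 1ℚ →
            dot (Face.c F) (combo ws) ≡ Face.δ F → ∀ {S} → S ∈supp ws → dot (Face.c F) (aS S) ≡ Face.δ F
supp⊆face F {ws} 0≤ws total onF {S} S∈ws = sym (x∙y⁻¹≈ε⇒x≈y δ (d S) (integral≡0 0≤ws slack-nonNeg slack≡0 S∈ws))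
  where
  open Face F
  d : Subset _ → ℚ
  d S = dot c (aS S)
  slack-nonNeg : ∀ S → 0ℚ ℚ.≤ δ - d S
  slack-nonNeg S = ≤⇒0≤- (valid (aS S) (aS∈P S))
  slack≡0 : integral ws (λ S → δ - d S) ≡ 0ℚ
  slack≡0 = identityʳ-unique δ _ (begin
    δ + integral ws (λ S → δ - d S)                 ≡⟨ cong (_+ integral ws (λ S → δ - d S)) (trans (sym onF) (dot-combo c ws)) ⟩
    integral ws d + integral ws (λ S → δ - d S)     ≡⟨ integral-+ ws d (λ S → δ - d S) ⟨
    integral ws (λ S → d S + (δ - d S))             ≡⟨ integral-cong ws (λ S → p+[q-p]≡q (d S) δ) ⟩
    integral ws (λ _ → δ)                           ≡⟨ integral-const ws δ ⟩
    weightSum ws * δ                                ≡⟨ trans (cong (_* δ) total) (ℚP.*-identityˡ δ) ⟩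
    δ                                               ∎)

-- Rounding fractional assignments

ℕtoℚ-sumℕ : ∀ {k} (f : Fin k → ℕ) → ℕtoℚ (sumℕ f) ≡ ∑[ i < k ] ℕtoℚ (f i)
ℕtoℚ-sumℕ {zero} f = refl
ℕtoℚ-sumℕ {suc k} f = trans (ℕtoℚ-+ (f zero) (sumℕ (f ∘ suc))) (cong (ℕtoℚ (f zero) +_) (ℕtoℚ-sumℕ (f ∘ suc)))

ℕtoℚ-𝟙 : ∀ x → ℕtoℚ (𝟙 x) ≡ b2q x
ℕtoℚ-𝟙 false = refl
ℕtoℚ-𝟙 true = refl

ℕtoℚ-count : ∀ {k} (P : Fin k → Bool) → ℕtoℚ (count P) ≡ ∑[ i < k ] b2q (P i)
ℕtoℚ-count P = trans (ℕtoℚ-sumℕ (λ i → 𝟙 (P i))) (sum-cong-≗ (λ i → ℕtoℚ-𝟙 (P i)))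

∑-ones : ∀ k → ∑[ i < k ] 1ℚ ≡ ℕtoℚ k
∑-ones zero = refl
∑-ones (suc k) = trans (cong (1ℚ +_) (∑-ones k)) (sym (ℕtoℚ-+ 1 k))

does⇒ : ∀ {P : Set} (d : Dec P) → does d ≡ true → P
does⇒ (yes p) _ = p

⇒does : ∀ {P : Set} (d : Dec P) → P → does d ≡ true
⇒does (yes _) _ = refl
⇒does (no ¬p) p = ⊥-elim (¬p p)

is-just⇒ : ∀ {A : Set} {x : Maybe A} → is-just x ≡ true → ∃[ a ] x ≡ just a
is-just⇒ {x = just a} _ = a , refl

module Rounding {m q : ℕ} (μ : Fin m → Fin q → ℚ) (μ-nonNeg : ∀ b j → 0ℚ ℚ.≤ μ b j)
                (μ-stochastic : ∀ b → ∑[ j < q ] μ b j ≡ 1ℚ) where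

  column : Fin q → ℚ
  column j = ∑[ b < m ] μ b j

  columns-total : ∑[ j < q ] column j ≡ ℕtoℚ m
  columns-total = trans (sym (∑-comm μ)) (trans (sum-cong-≗ μ-stochastic) (∑-ones m))

  R : Fin m → Fin q → Bool
  R b j = does (0ℚ ℚP.<? μ b j)

  open Hall R

  row-bound : ∀ J b → ∑[ j < q ] (if J j then μ b j else 0ℚ) ℚ.≤ b2q (neighbours J b)
  row-bound J b with neighbours J b in N≡
  ... | true = ℚP.≤-trans (sum-mono-≤ below) (ℚP.≤-reflexive (μ-stochastic b))
    where
    below : ∀ j → (if J j then μ b j else 0ℚ) ℚ.≤ μ b j
    below j with J j
    ... | true = ℚP.≤-refl
    ... | false = μ-nonNeg b j
  ... | false = ℚP.≤-trans (sum-mono-≤ vanish) (ℚP.≤-reflexive (sum-zero q))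
    where
    vanish : ∀ j → (if J j then μ b j else 0ℚ) ℚ.≤ 0ℚ
    vanish j with J j in Jj
    ... | false = ℚP.≤-refl
    ... | true = ℚP.≮⇒≥ (λ 0<μ → true≢false (trans (sym (neighbour 0<μ)) N≡))
      where
      neighbour : 0ℚ ℚ.< μ b j → neighbours J b ≡ true
      neighbour 0<μ = anyᵇ-intro (λ j → J j ∧ R b j) j (∧-intro Jj (⇒does (0ℚ ℚP.<? μ b j) 0<μ))

  module _ (c : Fin q → ℕ) (column≡c : ∀ j → column j ≡ ℕtoℚ (c j)) where

    hall-condition : HallCondition (λ _ → true) c
    hall-condition J = ℕtoℚ-cancel-≤ (ℚP.≤-trans (ℚP.≤-reflexive demand≡)
                                     (ℚP.≤-trans (sum-mono-≤ (row-bound J)) (ℚP.≤-reflexive supply≡)))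
      where
      restricted-column : ∀ j → ℕtoℚ (restrict J c j) ≡ ∑[ b < m ] (if J j then μ b j else 0ℚ)
      restricted-column j with J j
      ... | true = sym (column≡c j)
      ... | false = sym (sum-zero m)
      demand≡ : ℕtoℚ (demand c J) ≡ ∑[ b < m ] ∑[ j < q ] (if J j then μ b j else 0ℚ)
      demand≡ = begin
        ℕtoℚ (demand c J)                                  ≡⟨ ℕtoℚ-sumℕ (restrict J c) ⟩
        ∑[ j < q ] ℕtoℚ (restrict J c j)                   ≡⟨ sum-cong-≗ restricted-column ⟩
        ∑[ j < q ] ∑[ b < m ] (if J j then μ b j else 0ℚ)  ≡⟨ ∑-comm (λ j b → if J j then μ b j else 0ℚ) ⟩
        ∑[ b < m ] ∑[ j < q ] (if J j then μ b j else 0ℚ)  ∎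
      supply≡ : ∑[ b < m ] b2q (neighbours J b) ≡ ℕtoℚ (supply (λ _ → true) J)
      supply≡ = sym (ℕtoℚ-count (neighbours J))

    open Matching (hall (λ _ → true) c hall-condition)

    total-demand : sumℕ c ≡ m
    total-demand = ℕtoℚ-injective (begin
      ℕtoℚ (sumℕ c)            ≡⟨ ℕtoℚ-sumℕ c ⟩
      ∑[ j < q ] ℕtoℚ (c j)    ≡⟨ sum-cong-≗ column≡c ⟨
      ∑[ j < q ] column j      ≡⟨ columns-total ⟩
      ℕtoℚ m                   ∎)

    all-matched : ∀ b → is-just (match b) ≡ true
    all-matched = count-full (λ b → is-just (match b)) (begin
      sumℕ (λ b → 𝟙 (is-just (match b)))                   ≡⟨ sumℕ-cong (λ b → hits-total (match b)) ⟨
      sumℕ (λ b → sumℕ (λ j → 𝟙 (hits (match b) j)))       ≡⟨ sumℕ-comm (λ b j → 𝟙 (hits (match b) j)) ⟩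
      sumℕ (λ j → count (λ b → hits (match b) j))          ≡⟨ sumℕ-cong match-count ⟩
      sumℕ c                                               ≡⟨ total-demand ⟩
      m                                                    ∎)

    σ : Fin m → Fin q
    σ b = proj₁ (is-just⇒ (all-matched b))

    match≡σ : ∀ b → match b ≡ just (σ b)
    match≡σ b = proj₂ (is-just⇒ (all-matched b))

    σ-support : ∀ b → 0ℚ ℚ.< μ b (σ b)
    σ-support b = does⇒ (0ℚ ℚP.<? μ b (σ b)) (proj₂ (match-edge (match≡σ b)))

    σ-columns : ∀ j → ∑[ b < m ] b2q (does (σ b ≟ j)) ≡ column j
    σ-columns j = begin
      ∑[ b < m ] b2q (does (σ b ≟ j))             ≡⟨ sum-cong-≗ (λ b → cong (λ x → b2q (hits x j)) (match≡σ b)) ⟨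
      ∑[ b < m ] b2q (hits (match b) j)           ≡⟨ ℕtoℚ-count (λ b → hits (match b) j) ⟨
      ℕtoℚ (count (λ b → hits (match b) j))       ≡⟨ cong ℕtoℚ (match-count j) ⟩
      ℕtoℚ (c j)                                  ≡⟨ column≡c j ⟨
      column j                                    ∎

  round : (∀ j → ∃[ c ] column j ≡ ℕtoℚ c) →
          Σ[ σ ∈ (Fin m → Fin q) ] (∀ b → 0ℚ ℚ.< μ b (σ b)) × (∀ j → ∑[ b < m ] b2q (does (σ b ≟ j)) ≡ column j)
  round integral = σ c column≡c , σ-support c column≡c , σ-columns c column≡c
    where
    c : Fin q → ℕ
    c j = proj₁ (integral j)
    column≡c : ∀ j → column j ≡ ℕtoℚ (c j)
    column≡c j = proj₂ (integral j)

-- The column sums add up to m.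
integral-columns : ∀ {m q} (μ : Fin m → Fin (suc q) → ℚ) →
                   (∀ b j → 0ℚ ℚ.≤ μ b j) → (∀ b → ∑[ j < suc q ] μ b j ≡ 1ℚ) →
                   (∀ i → ∃[ c ] ∑[ b < m ] μ b (suc i) ≡ ℕtoℚ c) → ∀ j → ∃[ c ] ∑[ b < m ] μ b j ≡ ℕtoℚ c
integral-columns μ μ-nonNeg μ-stochastic integral (suc i) = integral i
integral-columns {m} {q} μ μ-nonNeg μ-stochastic integral zero = m ℕ.∸ s , column₀≡
  where
  open Rounding μ μ-nonNeg μ-stochastic using (column; columns-total)
  c : Fin q → ℕ
  c i = proj₁ (integral i)
  s : ℕ
  s = sumℕ c
  split : column zero + ℕtoℚ s ≡ ℕtoℚ m
  split = trans (cong (column zero +_) (trans (ℕtoℚ-sumℕ c) (sum-cong-≗ (λ i → sym (proj₂ (integral i)))))) columns-total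
  s≤m : s ≤ m
  s≤m = ℕtoℚ-cancel-≤ (subst₂ ℚ._≤_ (ℚP.+-identityˡ (ℕtoℚ s)) split
                               (ℚP.+-monoˡ-≤ (ℕtoℚ s) (sum-nonNeg (λ b → μ-nonNeg b zero))))
  column₀≡ : column zero ≡ ℕtoℚ (m ℕ.∸ s)
  column₀≡ = ∙-cancelʳ (ℕtoℚ s) (column zero) (ℕtoℚ (m ℕ.∸ s))
               (trans split (trans (cong ℕtoℚ (sym (ℕP.m∸n+n≡m s≤m))) (ℕtoℚ-+ (m ℕ.∸ s) s)))

-- Decompositions of a point of {0,r}^d

first : ∀ {k} → (Fin k → Bool) → Maybe (Fin k)
first {zero} S = nothing
first {suc k} S = if S zero then just zero else Maybe.map suc (first (S ∘ suc))

first-cong : ∀ {k} {S S′ : Fin k → Bool} → (∀ i → S i ≡ S′ i) → first S ≡ first S′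
first-cong {zero} _ = refl
first-cong {suc k} S≗S′ =
  cong₂ (λ x y → if x then just zero else Maybe.map suc y) (S≗S′ zero) (first-cong (S≗S′ ∘ suc))

first-sound : ∀ {k} (S : Fin k → Bool) {i} → first S ≡ just i → S i ≡ true
first-sound {suc k} S first≡ with S zero in S₀
first-sound {suc k} S refl | true = S₀
... | false with first (S ∘ suc) in rest≡
first-sound {suc k} S refl | false | just j = first-sound (S ∘ suc) rest≡

first-complete : ∀ {k} (S : Fin k → Bool) {i} → S i ≡ true → ∃[ j ] first S ≡ just j
first-complete {suc k} S {zero} S₀ rewrite S₀ = zero , refl
first-complete {suc k} S {suc i} Sᵢ with S zero
... | true = zero , refl
... | false with first-complete (S ∘ suc) Sᵢ
...   | j , rest≡ = suc j , cong (Maybe.map suc) rest≡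

block : ∀ {k} → (Fin k → Bool) → Fin (suc k)
block S = Maybe.maybe suc zero (first S)

block-cong : ∀ {k} {S S′ : Fin k → Bool} → (∀ i → S i ≡ S′ i) → block S ≡ block S′
block-cong S≗S′ = cong (Maybe.maybe suc zero) (first-cong S≗S′)

block≡suc⇒∈ : ∀ {k} (S : Fin k → Bool) {i} → block S ≡ suc i → S i ≡ true
block≡suc⇒∈ S block≡ with first S in first≡
block≡suc⇒∈ S refl | just i = first-sound S first≡

∈⇒block≡suc : ∀ {k} (S : Fin k → Bool) {i} → S i ≡ true → ∃[ j ] block S ≡ suc j
∈⇒block≡suc S Sᵢ with first-complete S Sᵢ
... | j , first≡ = j , cong (Maybe.maybe suc zero) first≡

b2q≢0 : ∀ {x} → b2q x ≢ 0ℚ → x ≡ true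
b2q≢0 {false} 0≢0 = ⊥-elim (0≢0 refl)
b2q≢0 {true} _ = refl

b2q-split : ∀ x y → b2q x ≡ b2q (x ∧ y) + b2q (x ∧ not y)
b2q-split false _ = refl
b2q-split true false = refl
b2q-split true true = refl

b2q-split′ : ∀ x y → b2q y ≡ b2q (x ∧ y) + b2q (y ∧ not x)
b2q-split′ false false = refl
b2q-split′ false true = refl
b2q-split′ true false = refl
b2q-split′ true true = refl

b2q-∧-not : ∀ {x y} → b2q (x ∧ not y) ≡ 0ℚ → b2q (y ∧ not x) ≡ 0ℚ → x ≡ y
b2q-∧-not {false} {false} _ _ = refl
b2q-∧-not {false} {true} _ y¬x≡0 = ⊥-elim (ℚP.1≢0 y¬x≡0)
b2q-∧-not {true} {false} x¬y≡0 _ = ⊥-elim (ℚP.1≢0 x¬y≡0)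
b2q-∧-not {true} {true} _ _ = refl

∑-b2q-δ : ∀ {k} (i : Fin k) → ∑[ j < k ] b2q (does (i ≟ j)) ≡ 1ℚ
∑-b2q-δ i = trans (sym (ℕtoℚ-count (λ j → does (i ≟ j)))) (cong ℕtoℚ (sumℕ-δ i (λ _ → 1)))

module Decomposition {n m : ℕ} (r : ℕ) (a : Vec n) (a∈0r : ∀ k → a k ≡ 0ℚ ⊎ a k ≡ ℕtoℚ r)
                     (ws : Fin m → List (ℚ × Subset n)) (ws-nonNeg : ∀ b → NonNegWeights (ws b))
                     (ws-total : ∀ b → weightSum (ws b) ≡ 1ℚ)
                     (a≡ : ∀ k → a k ≡ ∑[ b < m ] combo (ws b) k) where

  Supported : Subset n → Set
  Supported S = ∃[ b ] S ∈supp ws b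

  A : (Subset n → ℚ) → ℚ
  A φ = ∑[ b < m ] integral (ws b) φ

  a≡A : ∀ k → a k ≡ A (λ S → aS S k)
  a≡A k = trans (a≡ k) (sum-cong-≗ (λ b → combo≡integral (ws b) k))

  A-nonNeg : ∀ {φ} → (∀ S → 0ℚ ℚ.≤ φ S) → 0ℚ ℚ.≤ A φ
  A-nonNeg 0≤φ = sum-nonNeg (λ b → integral-nonNeg (ws-nonNeg b) 0≤φ)

  A≡0 : ∀ {φ} → (∀ S → 0ℚ ℚ.≤ φ S) → A φ ≡ 0ℚ → ∀ {S} → Supported S → φ S ≡ 0ℚ
  A≡0 0≤φ Aφ≡0 (b , S∈ws) =
    integral≡0 (ws-nonNeg b) 0≤φ (sum-nonNeg≡0 (λ b → integral-nonNeg (ws-nonNeg b) 0≤φ) Aφ≡0 b) S∈ws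

  A≢0 : ∀ {φ} → A φ ≢ 0ℚ → ∃[ S ] Supported S × φ S ≢ 0ℚ
  A≢0 {φ} Aφ≢0 with sum≢0 (λ b → integral (ws b) φ) Aφ≢0
  ... | b , I≢0 with integral≢0 (ws-nonNeg b) I≢0
  ...   | S , S∈ws , φS≢0 = S , (b , S∈ws) , φS≢0

  A-cong-supp : ∀ {φ ψ} → (∀ {S} → Supported S → φ S ≡ ψ S) → A φ ≡ A ψ
  A-cong-supp φ≗ψ = sum-cong-≗ (λ b → integral-cong-supp (ws-nonNeg b) (λ S∈ws → φ≗ψ (b , S∈ws)))

  A-+ : ∀ φ ψ → A (λ S → φ S + ψ S) ≡ A φ + A ψ
  A-+ φ ψ = trans (sum-cong-≗ (λ b → integral-+ (ws b) φ ψ)) (∑-distrib-+ (λ b → integral (ws b) φ) (λ b → integral (ws b) ψ))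

  a-nonNeg : ∀ k → 0ℚ ℚ.≤ a k
  a-nonNeg k = subst (0ℚ ℚ.≤_) (sym (a≡A k)) (A-nonNeg (λ S → proj₁ (aS-bounded S k)))

  zero-coordinate : ∀ k → a k ≡ 0ℚ → ∀ {S} → Supported S → aS S k ≡ 0ℚ
  zero-coordinate k ak≡0 = A≡0 (λ S → proj₁ (aS-bounded S k)) (trans (sym (a≡A k)) ak≡0)

  coordinate-split : ∀ k₁ k₂ ψ → (∀ S → aS S k₁ ≡ aS S k₂ + ψ S) → a k₁ ≡ a k₂ + A ψ
  coordinate-split k₁ k₂ ψ split = begin
    a k₁                                              ≡⟨ a≡A k₁ ⟩
    A (λ S → aS S k₁)                                 ≡⟨ A-cong-supp (λ {S} _ → split S) ⟩
    A (λ S → aS S k₂ + ψ S)                           ≡⟨ A-+ (λ S → aS S k₂) ψ ⟩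
    A (λ S → aS S k₂) + A ψ                           ≡⟨ cong (_+ A ψ) (a≡A k₂) ⟨
    a k₂ + A ψ                                        ∎

  -- a k₁ ≥ a k₂, and both lie in {0, r}.
  dominated : ∀ k₁ k₂ ψ → (∀ S → 0ℚ ℚ.≤ ψ S) → (∀ S → aS S k₁ ≡ aS S k₂ + ψ S) → a k₂ ≢ 0ℚ →
              a k₁ ≡ a k₂ × (∀ {S} → Supported S → ψ S ≡ 0ℚ)
  dominated k₁ k₂ ψ 0≤ψ split ak₂≢0 with a∈0r k₁ | a∈0r k₂ | coordinate-split k₁ k₂ ψ split
  ... | _ | inj₁ ak₂≡0 | _ = ⊥-elim (ak₂≢0 ak₂≡0)
  ... | inj₁ ak₁≡0 | inj₂ _ | ak₁≡ =
    ⊥-elim (ak₂≢0 (proj₁ (nonNeg+nonNeg≡0 (a-nonNeg k₂) (A-nonNeg 0≤ψ) (trans (sym ak₁≡) ak₁≡0))))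
  ... | inj₂ ak₁≡r | inj₂ ak₂≡r | ak₁≡ = ak₁≡ak₂ , A≡0 0≤ψ (identityʳ-unique (a k₂) (A ψ) (trans (sym ak₁≡) ak₁≡ak₂))
    where
    ak₁≡ak₂ : a k₁ ≡ a k₂
    ak₁≡ak₂ = trans ak₁≡r (sym ak₂≡r)

  module _ {u v : Fin n} (u<v : u <ᶠ v) (a-uv≢0 : a (inj₂ ((u , v) , u<v)) ≢ 0ℚ) where

    private
      uv : Idx n
      uv = inj₂ ((u , v) , u<v)
      via-u : a (inj₁ u) ≡ a uv × (∀ {S} → Supported S → b2q (S u ∧ not (S v)) ≡ 0ℚ)
      via-u = dominated (inj₁ u) uv (λ S → b2q (S u ∧ not (S v))) (λ S → b2q-nonNeg (S u ∧ not (S v)))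
                        (λ S → b2q-split (S u) (S v)) a-uv≢0
      via-v : a (inj₁ v) ≡ a uv × (∀ {S} → Supported S → b2q (S v ∧ not (S u)) ≡ 0ℚ)
      via-v = dominated (inj₁ v) uv (λ S → b2q (S v ∧ not (S u))) (λ S → b2q-nonNeg (S v ∧ not (S u)))
                        (λ S → b2q-split′ (S u) (S v)) a-uv≢0

    pair-node-coordinate : a (inj₁ u) ≡ a uv
    pair-node-coordinate = proj₁ via-u

    pair-uniform : ∀ {S} → Supported S → S u ≡ S v
    pair-uniform supp = b2q-∧-not (proj₂ via-u supp) (proj₂ via-v supp)

  pair≢0 : ∀ {S u v} → Supported S → S u ≡ true → S v ≡ true → (u<v : u <ᶠ v) → a (inj₂ ((u , v) , u<v)) ≢ 0ℚ
  pair≢0 {S} supp Su Sv u<v a-uv≡0 =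
    ℚP.1≢0 (trans (sym (cong₂ (λ x y → b2q (x ∧ y)) Su Sv)) (zero-coordinate (inj₂ ((_ , _) , u<v)) a-uv≡0 supp))

  linked : ∀ {S T i j} → Supported S → S i ≡ true → S j ≡ true → Supported T → T i ≡ T j
  linked {i = i} {j} sS Si Sj sT with FinP.<-cmp i j
  ... | tri< i<j _ _ = pair-uniform i<j (pair≢0 sS Si Sj i<j) sT
  ... | tri≈ _ refl _ = refl
  ... | tri> _ _ j<i = sym (pair-uniform j<i (pair≢0 sS Sj Si j<i) sT)

  overlapping⇒equal : ∀ {S T i} → Supported S → Supported T → S i ≡ true → T i ≡ true → ∀ j → S j ≡ T j
  overlapping⇒equal sS sT Si Ti j = BoolP.⇔→≡ {z = true} (mk⇔
    (λ Sj → trans (sym (linked sS Si Sj sT)) Ti)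
    (λ Tj → trans (sym (linked sT Ti Tj sS)) Si))

  ∈≡same-block : ∀ {S T i} → Supported S → Supported T → T i ≡ true → S i ≡ does (block S ≟ block T)
  ∈≡same-block {S} {T} {i} sS sT Ti with block S ≟ block T | ∈⇒block≡suc T Ti
  ... | yes same-block | j , blockT≡ =
    trans (overlapping⇒equal sS sT (block≡suc⇒∈ S (trans same-block blockT≡)) (block≡suc⇒∈ T blockT≡) i) Ti
  ... | no different-block | _ with S i in Si
  ...   | false = refl
  ...   | true = ⊥-elim (different-block (block-cong (overlapping⇒equal sS sT Si Ti)))

  μ : Fin m → Fin (suc n) → ℚ
  μ b j = integral (ws b) (λ S → b2q (does (block S ≟ j)))

  μ-nonNeg : ∀ b j → 0ℚ ℚ.≤ μ b j
  μ-nonNeg b j = integral-nonNeg (ws-nonNeg b) (λ S → b2q-nonNeg (does (block S ≟ j)))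

  μ-stochastic : ∀ b → ∑[ j < suc n ] μ b j ≡ 1ℚ
  μ-stochastic b = begin
    ∑[ j < suc n ] μ b j                                           ≡⟨ integral-∑ (ws b) (λ j S → b2q (does (block S ≟ j))) ⟨
    integral (ws b) (λ S → ∑[ j < suc n ] b2q (does (block S ≟ j))) ≡⟨ integral-cong (ws b) (λ S → ∑-b2q-δ (block S)) ⟩
    integral (ws b) (λ _ → 1ℚ)                                     ≡⟨ integral-const (ws b) 1ℚ ⟩
    weightSum (ws b) * 1ℚ                                          ≡⟨ cong (_* 1ℚ) (ws-total b) ⟩
    1ℚ                                                             ∎

  open Rounding μ μ-nonNeg μ-stochastic using (column; round)

  column-block : ∀ {T i} → Supported T → T i ≡ true → column (block T) ≡ a (inj₁ i)
  column-block {i = i} sT Ti = trans (A-cong-supp (λ sS → cong b2q (sym (∈≡same-block sS sT Ti)))) (sym (a≡A (inj₁ i)))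

  column-integral : ∀ i → ∃[ c ] column (suc i) ≡ ℕtoℚ c
  column-integral i with column (suc i) ℚP.≟ 0ℚ
  ... | yes column≡0 = 0 , column≡0
  ... | no column≢0 with A≢0 column≢0
  ...   | S , sS , S-in-block = value (a∈0r (inj₁ i))
    where
    block≡ : block S ≡ suc i
    block≡ = does⇒ (block S ≟ suc i) (b2q≢0 S-in-block)
    column≡a : column (suc i) ≡ a (inj₁ i)
    column≡a = trans (cong column (sym block≡)) (column-block sS (block≡suc⇒∈ S block≡))
    value : a (inj₁ i) ≡ 0ℚ ⊎ a (inj₁ i) ≡ ℕtoℚ r → ∃[ c ] column (suc i) ≡ ℕtoℚ c
    value (inj₁ a≡0) = 0 , trans column≡a a≡0
    value (inj₂ a≡r) = r , trans column≡a a≡r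

  module _ (S : Fin m → Subset n) (sS : ∀ b → Supported (S b))
           (columns : ∀ j → ∑[ b < m ] b2q (does (block (S b) ≟ j)) ≡ column j) where

    vanishing : ∀ k → a k ≡ 0ℚ → a k ≡ ∑[ b < m ] aS (S b) k
    vanishing k ak≡0 = trans ak≡0 (sym (trans (sum-cong-≗ (λ b → zero-coordinate k ak≡0 (sS b))) (sum-zero m)))

    node-coordinate : ∀ i → a (inj₁ i) ≡ ∑[ b < m ] b2q (S b i)
    node-coordinate i with a (inj₁ i) ℚP.≟ 0ℚ
    ... | yes ai≡0 = vanishing (inj₁ i) ai≡0
    ... | no ai≢0 with A≢0 (λ A≡0 → ai≢0 (trans (a≡A (inj₁ i)) A≡0))
    ...   | T , sT , Ti≢0 = sym (begin
      ∑[ b < m ] b2q (S b i)                              ≡⟨ sum-cong-≗ (λ b → cong b2q (∈≡same-block (sS b) sT Ti)) ⟩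
      ∑[ b < m ] b2q (does (block (S b) ≟ block T))       ≡⟨ columns (block T) ⟩
      column (block T)                                    ≡⟨ column-block sT Ti ⟩
      a (inj₁ i)                                          ∎)
      where
      Ti : T i ≡ true
      Ti = b2q≢0 Ti≢0

    pair-coordinate : ∀ {u v} (u<v : u <ᶠ v) → a (inj₂ ((u , v) , u<v)) ≡ ∑[ b < m ] b2q (S b u ∧ S b v)
    pair-coordinate {u} {v} u<v with a (inj₂ ((u , v) , u<v)) ℚP.≟ 0ℚ
    ... | yes a-uv≡0 = vanishing (inj₂ ((u , v) , u<v)) a-uv≡0
    ... | no a-uv≢0 = begin
      a (inj₂ ((u , v) , u<v))               ≡⟨ pair-node-coordinate u<v a-uv≢0 ⟨
      a (inj₁ u)                             ≡⟨ node-coordinate u ⟩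
      ∑[ b < m ] b2q (S b u)                 ≡⟨ sum-cong-≗ (λ b → cong b2q (both b)) ⟩
      ∑[ b < m ] b2q (S b u ∧ S b v)         ∎
      where
      both : ∀ b → S b u ≡ S b u ∧ S b v
      both b = trans (sym (BoolP.∧-idem (S b u))) (cong (S b u ∧_) (pair-uniform u<v a-uv≢0 (sS b)))

    decomposes : ∀ k → a k ≡ ∑[ b < m ] aS (S b) k
    decomposes (inj₁ i) = node-coordinate i
    decomposes (inj₂ ((u , v) , u<v)) = pair-coordinate u<v

  decomposition : Σ[ S ∈ (Fin m → Subset n) ] (∀ b → S b ∈supp ws b) × (∀ k → a k ≡ ∑[ b < m ] aS (S b) k)
  decomposition = S , S∈ws , decomposes S (λ b → b , S∈ws b) columns
    where
    rounded : Σ[ σ ∈ (Fin m → Fin (suc n)) ] (∀ b → 0ℚ ℚ.< μ b (σ b)) ×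
                                             (∀ j → ∑[ b < m ] b2q (does (σ b ≟ j)) ≡ column j)
    rounded = round (integral-columns μ μ-nonNeg μ-stochastic column-integral)
    σ : Fin m → Fin (suc n)
    σ = proj₁ rounded
    chosen : ∀ b → ∃[ S ] S ∈supp ws b × b2q (does (block S ≟ σ b)) ≢ 0ℚ
    chosen b = integral≢0 (ws-nonNeg b) (λ μ≡0 → ℚP.<⇒≢ (proj₁ (proj₂ rounded) b) (sym μ≡0))
    S : Fin m → Subset n
    S b = proj₁ (chosen b)
    S∈ws : ∀ b → S b ∈supp ws b
    S∈ws b = proj₁ (proj₂ (chosen b))
    block≡σ : ∀ b → block (S b) ≡ σ b
    block≡σ b = does⇒ (block (S b) ≟ σ b) (b2q≢0 (proj₂ (proj₂ (chosen b))))
    columns : ∀ j → ∑[ b < m ] b2q (does (block (S b) ≟ j)) ≡ column j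
    columns j = trans (sum-cong-≗ (λ b → cong (λ x → b2q (does (x ≟ j))) (block≡σ b))) (proj₂ (proj₂ rounded) j)

proposition4p2 : (n m : ℕ) → 1 ≤ n → 1 ≤ m → (r : ℕ) → (a : Vec n)
    → (∀ k → a k ≡ 0ℚ ⊎ a k ≡ ℕtoℚ r)
    → (F : Fin m → Face n) → InMinkowski a F
    → ∃[ χ ] ((∀ b → IsVertex (F b) (χ b)) × (∀ k → a k ≡ sumVecs {n} {m} χ k))
proposition4p2 n m _ _ r a a∈0r F (x , x∈F , a≡Σx) =
  (λ b → aS (S b)) ,
  (λ b → aS-vertex (F b) (S b) (supp⊆face (F b) (ws-nonNeg b) (ws-total b) (x-on-face b) (S∈ws b))) ,
  (λ k → trans (a≡ΣaS k) (sym (sumFin≡sum (λ b → aS (S b) k))))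
  where
  ws : Fin m → List (ℚ × Subset n)
  ws b = proj₁ (proj₁ (x∈F b))
  ws-nonNeg : ∀ b → NonNegWeights (ws b)
  ws-nonNeg b = proj₁ (proj₂ (proj₁ (x∈F b)))
  ws-total : ∀ b → weightSum (ws b) ≡ 1ℚ
  ws-total b = proj₁ (proj₂ (proj₂ (proj₁ (x∈F b))))
  x≡combo : ∀ b k → x b k ≡ combo (ws b) k
  x≡combo b = proj₂ (proj₂ (proj₂ (proj₁ (x∈F b))))
  x-on-face : ∀ b → dot (Face.c (F b)) (combo (ws b)) ≡ Face.δ (F b)
  x-on-face b = trans (sym (dot-cong (Face.c (F b)) (x≡combo b))) (proj₂ (x∈F b))
  a≡Σcombo : ∀ k → a k ≡ ∑[ b < m ] combo (ws b) k
  a≡Σcombo k = trans (a≡Σx k) (trans (sumFin≡sum (λ b → x b k)) (sum-cong-≗ (λ b → x≡combo b k)))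
  open Decomposition r a a∈0r ws ws-nonNeg ws-total a≡Σcombo using (decomposition)
  S : Fin m → Subset n
  S = proj₁ decomposition
  S∈ws : ∀ b → S b ∈supp ws b
  S∈ws = proj₁ (proj₂ decomposition)
  a≡ΣaS : ∀ k → a k ≡ ∑[ b < m ] aS (S b) k
  a≡ΣaS = proj₂ (proj₂ decomposition)
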